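{- Let $\mathcal T$ be a tower diagram, $\omega=\omega_{\mathcal T}$, and let $i<j$ be positive integers. Let $s$ be the tower of $\mathcal T$ whose index is $i$ and $l$ the tower whose index is $j$. Then $\ell(\omega t_{i,j})=\ell(\omega)+1$ only if $s<l$. Moreover, if $\ell(\omega t_{i,j})=\ell(\omega)+1$ and $\mathcal T'=\mathcal T_{\omega t_{i,j}}$, then: (1) $\mathcal T'$ is obtained from $\mathcal T$ by modifying only the $s$-th and $l$-th towers: a new cell is added to tower $s$ and possibly some cells are moved from tower $l$ to tower $s$, i.e. there is $r\ge0$ with $\mathcal T'_s=\mathcal T_s+r+1$, $\mathcal T'_l=\mathcal T_l-r$ and $\mathcal T'_p=\mathcal T_p$ for $p\ne s,l$; (2) $j$ is the index in $\mathcal T'$ of the tower whose height increased (tower $s$); (3) $i$ is the index in $\mathcal T'$ of the other modified tower (tower $l$); (4) the new cell $(s,\mathcal T_s)$ has flight number $i$ in $\mathcal T'$.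
   Context: Permutations compose as functions; $t_{a,b}$ transposes $a,b$; $s_p=t_{p,p+1}$; $\ell$ is length. A tower diagram is a sequence $\mathcal T=(\mathcal T_1,\mathcal T_2,\ldots)$ of nonnegative integers, almost all zero. A cell is the south-east corner $(a,b)$ ($a\ge1,b\ge0$) of $[a-1,a]\times[b,b+1]$; $(a,b)\in\mathcal T$ iff $b<\mathcal T_a$. Sliding $i$ into $\mathcal T$: set $s:=i$, examine towers $p=1,2,\ldots$ with $h=\mathcal T_p$: if $s>p+h$ go on; if $s=p+h$ increase $\mathcal T_p$ by one and stop; if $h\ge1$ and $s=p+h-1$ decrease $\mathcal T_p$ by one and stop; if $s<p+h-1$ set $s:=s+1$ and go on. $\mathcal T_\omega$ is obtained by sliding the letters of a reduced word of $\omega=s_{\alpha_1}\cdots s_{\alpha_l}$ in order into the empty diagram; $\omega\mapsto\mathcal T_\omega$ is a bijection with inverse $\mathcal T\mapsto\omega_{\mathcal T}$. Flight path: for $c=(a,b)$, $\mathrm{fp}(\mathcal T,c)=\{c\}$ if $a=1$; otherwise with $d=(a-1,b)$, $e=(a-1,b+1)$, $\mathrm{fp}(\mathcal T,c)=\mathrm{fp}(\mathcal T,d)\cup\{c\}$ if $d\in\mathcal T$, else $\mathrm{fp}(\mathcal T,e)\cup\{c\}$. If $(1,y)\in\mathrm{fp}(\mathcal T,c)$, the flight number is $\mathrm{fn}(\mathcal T,c)=1+y$. The index of the $p$-th tower of $\mathcal T$ is $\mathrm{fn}(\mathcal T,(p,\mathcal T_p))$, the flight number of the lowest empty cell above that tower.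 -}

module Defs where

open import Data.Nat using (ℕ; zero; suc; _+_; _∸_; _≤_; _<_; _<ᵇ_; _≡ᵇ_)
open import Data.Bool using (Bool; true; false; if_then_else_; _∧_)
open import Data.List using (List; []; _∷_; _++_; [_]; replicate; foldl; length)
open import Data.List.Relation.Unary.All using (All)
open import Data.Product using (Σ; _×_)
open import Relation.Binary.PropositionalEquality using (_≡_)

transp : ℕ → ℕ → ℕ → ℕ
transp a b x = if x ≡ᵇ a then b else (if x ≡ᵇ b then a else x)

sₚ : ℕ → ℕ → ℕ
sₚ p = transp p (suc p)

-- the permutation s_{a1} ∘ s_{a2} ∘ ... ∘ s_{al} of the word a1 a2 ... al
-- (functions compose: the last letter acts first)
evalW : List ℕ → ℕ → ℕ
evalW []      x = x
evalW (a ∷ w) x = sₚ a (evalW w x)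

Word : List ℕ → Set
Word w = All (1 ≤_) w

WordFor : List ℕ → (ℕ → ℕ) → Set
WordFor w f = Word w × (∀ x → evalW w x ≡ f x)

ReducedWordFor : List ℕ → (ℕ → ℕ) → Set
ReducedWordFor w f = WordFor w f × (∀ v → WordFor v f → length w ≤ length v)

HasLength : (ℕ → ℕ) → ℕ → Set
HasLength f n = Σ (List ℕ) λ w → ReducedWordFor w f × length w ≡ n

-- Tower diagrams: the list (T₁, T₂, …, T_k), all later towers are 0.

Tower : Set
Tower = List ℕ

-- height of the p-th tower (p ≥ 1); ht T 0 = 0 is a junk value
ht : Tower → ℕ → ℕ
ht T       zero          = 0
ht []      (suc p)       = 0
ht (h ∷ T) (suc zero)    = h
ht (h ∷ T) (suc (suc p)) = ht T (suc p)

-- sliding: slideAux p s T examines towers p, p+1, ... (T is the list from tower p on)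
slideAux : ℕ → ℕ → List ℕ → List ℕ
slideAux p s []      = replicate (s ∸ p) 0 ++ [ 1 ]   -- all remaining heights are 0
slideAux p s (h ∷ T) =
  if p + h <ᵇ s then h ∷ slideAux (suc p) s T
  else if s ≡ᵇ p + h then suc h ∷ T
  else if (0 <ᵇ h) ∧ (suc s ≡ᵇ p + h) then (h ∸ 1) ∷ T
  else h ∷ slideAux (suc p) (suc s) T

slide : ℕ → Tower → Tower
slide i T = slideAux 1 i T

slideWord : List ℕ → Tower
slideWord w = foldl (λ T a → slide a T) [] w

-- equality of tower diagrams (lists may differ by trailing zeros)
_≈T_ : Tower → Tower → Set
T ≈T U = ∀ p → ht T p ≡ ht U p

-- Flight numbers.  fnC T k b = flight number of the cell (k+1, b):
-- from (a,b), a ≥ 2, go to d = (a-1,b) if d ∈ T (i.e. b < T_{a-1}),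
-- else to e = (a-1,b+1); at (1,y) the flight number is 1 + y.

fnC : Tower → ℕ → ℕ → ℕ
fnC T zero    b = suc b
fnC T (suc k) b = if b <ᵇ ht T (suc k) then fnC T k b else fnC T k (suc b)

fn : Tower → ℕ → ℕ → ℕ
fn T a b = fnC T (a ∸ 1) b

-- index of the p-th tower: flight number of the lowest empty cell above it
index : Tower → ℕ → ℕ
index T p = fn T p (ht T p)

module Submission where

open import Defs
open import Data.Nat using (ℕ; zero; suc; _+_; _∸_; _≤_; _<_; _<ᵇ_; _≡ᵇ_; z≤n; s≤s; _≟_; _≤?_; _<?_; _⊔_)
open import Data.Nat.Properties
open import Data.Bool using (Bool; true; false; if_then_else_; _∧_)
open import Data.List using (List; []; _∷_; _++_; [_]; _∷ʳ_; length; foldr; replicate)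
open import Data.List.Properties using (length-++; foldl-∷ʳ)
open import Data.List.Relation.Unary.All using (All; []; _∷_)
open import Data.List.Relation.Unary.All.Properties using (∷ʳ⁺; ∷ʳ⁻)
open import Data.List.Reverse using (Reverse; []; _∶_∶ʳ_; reverseView)
open import Data.Empty using (⊥; ⊥-elim)
open import Data.Product using (Σ; _×_; _,_; proj₁; proj₂)
open import Data.Sum using (_⊎_; inj₁; inj₂)
open import Function.Definitions using (Injective)
open import Relation.Nullary using (¬_; Dec; yes; no; does)
open import Relation.Nullary.Decidable using (dec-true; dec-false)
open import Relation.Binary.Definitions using (Tri; tri<; tri≈; tri>)
open import Relation.Binary.PropositionalEquality hiding ([_])
open import Data.Nat.Tactic.RingSolver using (solve-∀)

-- Proof idea.  Everything is reduced to the classical description of a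
-- permutation ω (inverse π) by inversions and by its code
--     code ω π p = #{u < π(p) ∣ ω(u) ≥ p}.
--
--  1. Coxeter length is the number of inversions: a word of length k creates
--     at most k inversions, and a permutation of {1..n} with k inversions is
--     a word of length k (peel off descents).
--  2. Precomposing ω with t_{i,j}, where ω(i) < ω(j), adds 1 + 2B inversions,
--     B = #{i < u < j ∣ ω(i) < ω(u) < ω(j)}.  So ℓ(ω t_{i,j}) = ℓ(ω) + 1
--     forces ω(i) < ω(j) and B = 0 (this gives the first claim, s < l).
--  3. Sliding a reduced word of ω yields the diagram whose p-th tower is
--     code ω π p (induction along the word, one slide at a time), and in
--     that diagram the flight path above tower p ends at π(p): index = π.
--  4. Hence the towers of index i and j are s = ω(i) and l = ω(j), and
--     comparing the codes of ω and ω t_{i,j} tower by tower gives (1)–(4).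

bit : Bool → ℕ
bit true  = 1
bit false = 0

<ᵇ-true : ∀ {m n} → m < n → (m <ᵇ n) ≡ true
<ᵇ-true {m} {n} = dec-true (m <? n)

<ᵇ-false : ∀ {m n} → ¬ m < n → (m <ᵇ n) ≡ false
<ᵇ-false {m} {n} = dec-false (m <? n)

≡ᵇ-true : ∀ {m n} → m ≡ n → (m ≡ᵇ n) ≡ true
≡ᵇ-true {m} {n} = dec-true (m ≟ n)

≡ᵇ-false : ∀ {m n} → m ≢ n → (m ≡ᵇ n) ≡ false
≡ᵇ-false {m} {n} = dec-false (m ≟ n)

bit-< : ∀ {m n} → m < n → bit (m <ᵇ n) ≡ 1
bit-< p = cong bit (<ᵇ-true p)

bit-≮ : ∀ {m n} → ¬ m < n → bit (m <ᵇ n) ≡ 0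
bit-≮ p = cong bit (<ᵇ-false p)

<ᵇ-cong : ∀ {m n m' n'} → (m < n → m' < n') → (m' < n' → m < n) → (m <ᵇ n) ≡ (m' <ᵇ n')
<ᵇ-cong {m} {n} f g with m <? n
... | yes p = trans (<ᵇ-true p) (sym (<ᵇ-true (f p)))
... | no ¬p = trans (<ᵇ-false ¬p) (sym (<ᵇ-false (λ q → ¬p (g q))))

-- Case analysis on a conditional whose test is a decision procedure
-- (m <ᵇ n is definitionally  does (m <? n)).
if-dec : ∀ {A B : Set} (P : B → Set) (d : Dec A) {x y : B} →
         (A → P x) → (¬ A → P y) → P (if does d then x else y)
if-dec P (yes a) f g = f a
if-dec P (no ¬a) f g = g ¬a

sumTo : (ℕ → ℕ) → ℕ → ℕ
sumTo f zero    = 0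
sumTo f (suc k) = sumTo f k + f k

count : (ℕ → Bool) → ℕ → ℕ
count P = sumTo (λ u → bit (P u))

sumTo-cong : ∀ {f g} k → (∀ u → u < k → f u ≡ g u) → sumTo f k ≡ sumTo g k
sumTo-cong zero    eq = refl
sumTo-cong (suc k) eq = cong₂ _+_ (sumTo-cong k (λ u u<k → eq u (m<n⇒m<1+n u<k))) (eq k ≤-refl)

sumTo-+ : ∀ f a k → sumTo f (a + k) ≡ sumTo f a + sumTo (λ t → f (a + t)) k
sumTo-+ f a zero    = trans (cong (sumTo f) (+-identityʳ a)) (sym (+-identityʳ _))
sumTo-+ f a (suc k) = begin
  sumTo f (a + suc k)                          ≡⟨ cong (sumTo f) (+-suc a k) ⟩
  sumTo f (a + k) + f (a + k)                  ≡⟨ cong (_+ f (a + k)) (sumTo-+ f a k) ⟩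
  sumTo f a + sumTo (λ t → f (a + t)) k + f (a + k) ≡⟨ +-assoc (sumTo f a) _ _ ⟩
  sumTo f a + (sumTo (λ t → f (a + t)) k + f (a + k)) ∎
  where open ≡-Reasoning

sumTo-split : ∀ f a k → sumTo f (suc (a + k)) ≡ sumTo f a + f a + sumTo (λ t → f (suc (a + t))) k
sumTo-split f a k = sumTo-+ f (suc a) k

sumTo-split₂ : ∀ f i d e → sumTo f (suc (suc (i + d) + e)) ≡
  sumTo f i + f i + sumTo (λ t → f (suc (i + t))) d + f (suc (i + d)) + sumTo (λ t → f (suc (suc (i + d) + t))) e
sumTo-split₂ f i d e =
  trans (sumTo-split f (suc (i + d)) e)
        (cong (λ z → z + f (suc (i + d)) + sumTo (λ t → f (suc (suc (i + d) + t))) e) (sumTo-split f i d))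

sumTo-distrib : ∀ f g k → sumTo (λ u → f u + g u) k ≡ sumTo f k + sumTo g k
sumTo-distrib f g zero    = refl
sumTo-distrib f g (suc k) =
  trans (cong (_+ (f k + g k)) (sumTo-distrib f g k)) (shuffle (sumTo f k) (sumTo g k) (f k) (g k))
  where
  shuffle : ∀ a b c d → a + b + (c + d) ≡ a + c + (b + d)
  shuffle = solve-∀

sumTo-mono : ∀ f {a b} → a ≤ b → sumTo f a ≤ sumTo f b
sumTo-mono f {a} a≤b with m≤n⇒∃[o]m+o≡n a≤b
... | o , refl = subst (sumTo f a ≤_) (sym (sumTo-+ f a o)) (m≤m+n _ _)

sumTo≡0 : ∀ f k → sumTo f k ≡ 0 → ∀ u → u < k → f u ≡ 0
sumTo≡0 f (suc k) eq u u<k with u ≟ k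
... | yes refl = m+n≡0⇒n≡0 (sumTo f k) eq
... | no u≢k   = sumTo≡0 f k (m+n≡0⇒m≡0 (sumTo f k) eq) u (≤∧≢⇒< (≤-pred u<k) u≢k)

sumTo-zeros : ∀ k → sumTo (λ _ → 0) k ≡ 0
sumTo-zeros zero    = refl
sumTo-zeros (suc k) = trans (+-identityʳ _) (sumTo-zeros k)

transp-a : ∀ a b → transp a b a ≡ b
transp-a a b rewrite ≡ᵇ-true (refl {x = a}) = refl

transp-b : ∀ a b → transp a b b ≡ a
transp-b a b with b ≟ a
... | yes refl = transp-a a a
... | no b≢a rewrite ≡ᵇ-false b≢a | ≡ᵇ-true (refl {x = b}) = refl

transp-other : ∀ a b x → x ≢ a → x ≢ b → transp a b x ≡ x
transp-other a b x x≢a x≢b rewrite ≡ᵇ-false x≢a | ≡ᵇ-false x≢b = refl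

data TranspCase (a b x : ℕ) : Set where
  at-a  : x ≡ a → transp a b x ≡ b → TranspCase a b x
  at-b  : x ≡ b → x ≢ a → transp a b x ≡ a → TranspCase a b x
  other : x ≢ a → x ≢ b → transp a b x ≡ x → TranspCase a b x

transpCase : ∀ a b x → TranspCase a b x
transpCase a b x with x ≟ a | x ≟ b
... | yes refl | _        = at-a refl (transp-a a b)
... | no x≢a   | yes refl = at-b refl x≢a (transp-b a b)
... | no x≢a   | no x≢b   = other x≢a x≢b (transp-other a b x x≢a x≢b)

transp-involutive : ∀ a b x → transp a b (transp a b x) ≡ x
transp-involutive a b x with transpCase a b x
... | at-a refl eq   = trans (cong (transp a b) eq) (transp-b a b)
... | at-b refl _ eq = trans (cong (transp a b) eq) (transp-a a b)
... | other _ _ eq   = trans (cong (transp a b) eq) eq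

transp-fix-below : ∀ i j x → x < i → i < j → transp i j x ≡ x
transp-fix-below i j x x<i i<j = transp-other i j x (λ e → <-irrefl e x<i) (λ e → <-irrefl e (<-trans x<i i<j))

transp-fix-between : ∀ i j x → i < x → x < j → transp i j x ≡ x
transp-fix-between i j x i<x x<j = transp-other i j x (λ e → <-irrefl (sym e) i<x) (λ e → <-irrefl e x<j)

transp-fix-above : ∀ i j x → i < j → j < x → transp i j x ≡ x
transp-fix-above i j x i<j j<x = transp-other i j x (λ e → <-irrefl (sym e) (<-trans i<j j<x)) (λ e → <-irrefl (sym e) j<x)

-- With j = 1+i+d, the positions strictly between i and j are 1+i+t (t < d)
-- and those beyond j are 1+j+t.
after : ∀ i t → i < suc (i + t)
after i t = s≤s (m≤m+n i t)

within : ∀ i {t d} → t < d → suc (i + t) < suc (i + d)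
within i t<d = s≤s (+-monoʳ-< i t<d)

beyond : ∀ i d t → suc (i + d) < suc (suc (i + d) + t)
beyond i d t = s≤s (s≤s (m≤m+n (i + d) t))

count-transp : ∀ (P : ℕ → Bool) i d e → let j = suc (i + d) ; N = suc (j + e) in
  count (λ x → P (transp i j x)) N ≡ count P N
count-transp P i d e = begin
  count Q N
    ≡⟨ sumTo-split₂ (λ u → bit (Q u)) i d e ⟩
  count Q i + bit (Q i) + sumTo (λ t → bit (Q (suc (i + t)))) d + bit (Q j) + sumTo (λ t → bit (Q (suc (j + t)))) e
    ≡⟨ cong₅ below (cong (λ z → bit (P z)) (transp-a i j)) between (cong (λ z → bit (P z)) (transp-b i j)) above ⟩
  count P i + bit (P j) + Mid + bit (P i) + High
    ≡⟨ swap (count P i) (bit (P j)) Mid (bit (P i)) High ⟩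
  count P i + bit (P i) + Mid + bit (P j) + High
    ≡⟨ sym (sumTo-split₂ (λ u → bit (P u)) i d e) ⟩
  count P N ∎
  where
  open ≡-Reasoning
  j : ℕ
  j = suc (i + d)
  N : ℕ
  N = suc (j + e)
  Q : ℕ → Bool
  Q = λ x → P (transp i j x)
  Mid : ℕ
  Mid = sumTo (λ t → bit (P (suc (i + t)))) d
  High : ℕ
  High = sumTo (λ t → bit (P (suc (j + t)))) e
  i<j : i < j
  i<j = after i d
  cong₅ : ∀ {a a' b b' c c' x x' y y'} → a ≡ a' → b ≡ b' → c ≡ c' → x ≡ x' → y ≡ y' →
          a + b + c + x + y ≡ a' + b' + c' + x' + y'
  cong₅ refl refl refl refl refl = refl
  below : count Q i ≡ count P i
  below = sumTo-cong i (λ u u<i → cong (λ z → bit (P z)) (transp-fix-below i j u u<i i<j))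
  between : sumTo (λ t → bit (Q (suc (i + t)))) d ≡ Mid
  between = sumTo-cong d (λ t t<d → cong (λ z → bit (P z)) (transp-fix-between i j _ (after i t) (within i t<d)))
  above : sumTo (λ t → bit (Q (suc (j + t)))) e ≡ High
  above = sumTo-cong e (λ t _ → cong (λ z → bit (P z)) (transp-fix-above i j _ i<j (beyond i d t)))
  swap : ∀ a b c x y → a + b + c + x + y ≡ a + x + c + b + y
  swap = solve-∀

count-sₚ : ∀ (P : ℕ → Bool) a e → count (λ x → P (sₚ a x)) (suc (suc a + e)) ≡ count P (suc (suc a + e))
count-sₚ P a e = subst Invariant (+-identityʳ a) (count-transp P a 0 e)
  where
  Invariant : ℕ → Set
  Invariant b = count (λ x → P (transp a (suc b) x)) (suc (suc b + e)) ≡ count P (suc (suc b + e))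

-- Inversions.

inversionsAt : (ℕ → ℕ) → ℕ → ℕ
inversionsAt g y = count (λ x → g y <ᵇ g x) y

inversions : (ℕ → ℕ) → ℕ → ℕ
inversions g N = sumTo (inversionsAt g) N

inversions-cong : ∀ {g h} N → (∀ x → g x ≡ h x) → inversions g N ≡ inversions h N
inversions-cong N eq = sumTo-cong N (λ y _ → sumTo-cong y (λ x _ → cong bit (cong₂ _<ᵇ_ (eq y) (eq x))))

inj-transp : ∀ (g : ℕ → ℕ) i j → Injective _≡_ _≡_ g → Injective _≡_ _≡_ (λ x → g (transp i j x))
inj-transp g i j inj {x} {y} e =
  trans (sym (transp-involutive i j x)) (trans (cong (transp i j) (inj e)) (transp-involutive i j y))

between : ℕ → ℕ → ℕ → Bool
between a b v = (a <ᵇ v) ∧ (v <ᵇ b)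

between-bits : ∀ a b v → a < b → v ≢ a → v ≢ b →
  bit (a <ᵇ v) + bit (v <ᵇ b) ≡ bit (b <ᵇ v) + bit (v <ᵇ a) + (bit (between a b v) + bit (between a b v))
between-bits a b v a<b v≢a v≢b with <-cmp a v | <-cmp v b
... | tri< a<v _ _ | tri< v<b _ _
  rewrite <ᵇ-true a<v | <ᵇ-true v<b | <ᵇ-false (<⇒≯ v<b) | <ᵇ-false (<⇒≯ a<v) = refl
... | tri< a<v _ _ | tri> _ _ b<v
  rewrite <ᵇ-true a<v | <ᵇ-false (<⇒≯ b<v) | <ᵇ-true b<v | <ᵇ-false (<⇒≯ a<v) = refl
... | tri> _ _ v<a | tri< v<b _ _
  rewrite <ᵇ-false (<⇒≯ v<a) | <ᵇ-true v<b | <ᵇ-false (<⇒≯ v<b) | <ᵇ-true v<a = refl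
... | tri> _ _ v<a | tri> _ _ b<v = ⊥-elim (<-asym (<-trans v<a a<b) b<v)
... | tri< _ _ _   | tri≈ _ v≡b _ = ⊥-elim (v≢b v≡b)
... | tri> _ _ _   | tri≈ _ v≡b _ = ⊥-elim (v≢b v≡b)
... | tri≈ _ a≡v _ | _            = ⊥-elim (v≢a (sym a≡v))

-- Only the contributions of the positions i, j and the positions between
-- them change; the result is  inv(g) + 1 + 2·Between.
module TranspositionInversions (g : ℕ → ℕ) (inj : Injective _≡_ _≡_ g) (i d e : ℕ) where
  j : ℕ
  j = suc (i + d)
  N : ℕ
  N = suc (j + e)
  τ : ℕ → ℕ
  τ = transp i j
  g' : ℕ → ℕ
  g' = λ x → g (τ x)
  i<j : i < j
  i<j = after i d
  f : ℕ → ℕ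
  f = inversionsAt g
  f' : ℕ → ℕ
  f' = inversionsAt g'

  aboveᵢ-before : ℕ
  aboveᵢ-before = count (λ x → g i <ᵇ g x) i
  aboveⱼ-before : ℕ
  aboveⱼ-before = count (λ x → g j <ᵇ g x) i
  aboveᵢ-mid : ℕ
  aboveᵢ-mid = sumTo (λ t → bit (g i <ᵇ g (suc (i + t)))) d
  aboveⱼ-mid : ℕ
  aboveⱼ-mid = sumTo (λ t → bit (g j <ᵇ g (suc (i + t)))) d
  belowᵢ-mid : ℕ
  belowᵢ-mid = sumTo (λ t → bit (g (suc (i + t)) <ᵇ g i)) d
  belowⱼ-mid : ℕ
  belowⱼ-mid = sumTo (λ t → bit (g (suc (i + t)) <ᵇ g j)) d
  Between : ℕ
  Between = sumTo (λ t → bit (between (g i) (g j) (g (suc (i + t))))) d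
  mid : ℕ
  mid = sumTo (λ t → f  (suc (i + t))) d
  mid' : ℕ
  mid' = sumTo (λ t → f' (suc (i + t))) d
  high : ℕ
  high = sumTo (λ t → f (suc (j + t))) e

  before-i : sumTo f' i ≡ sumTo f i
  before-i = sumTo-cong i (λ y y<i → sumTo-cong y (λ x x<y → cong bit (cong₂ _<ᵇ_
    (cong g (transp-fix-below i j y y<i i<j)) (cong g (transp-fix-below i j x (<-trans x<y y<i) i<j)))))

  after-j : sumTo (λ t → f' (suc (j + t))) e ≡ high
  after-j = sumTo-cong e (λ t _ → trans
    (sumTo-cong (suc (j + t)) (λ x _ → cong (λ z → bit (g z <ᵇ g (τ x))) (transp-fix-above i j _ i<j (beyond i d t))))
    (count-transp (λ x → g (suc (j + t)) <ᵇ g x) i d t))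

  at-i : f' i ≡ aboveⱼ-before
  at-i = sumTo-cong i (λ x x<i → cong bit (cong₂ _<ᵇ_ (cong g (transp-a i j)) (cong g (transp-fix-below i j x x<i i<j))))

  at-j : f' j ≡ aboveᵢ-before + bit (g i <ᵇ g j) + aboveᵢ-mid
  at-j = begin
    count (λ x → g (τ j) <ᵇ g (τ x)) j
      ≡⟨ cong (λ z → count (λ x → g z <ᵇ g (τ x)) j) (transp-b i j) ⟩
    count (λ x → g i <ᵇ g (τ x)) j
      ≡⟨ sumTo-split (λ x → bit (g i <ᵇ g (τ x))) i d ⟩
    count (λ x → g i <ᵇ g (τ x)) i + bit (g i <ᵇ g (τ i)) + sumTo (λ t → bit (g i <ᵇ g (τ (suc (i + t))))) d
      ≡⟨ cong₂ (λ a b → a + bit (g i <ᵇ g b) + sumTo (λ t → bit (g i <ᵇ g (τ (suc (i + t))))) d) before (transp-a i j) ⟩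
    aboveᵢ-before + bit (g i <ᵇ g j) + sumTo (λ t → bit (g i <ᵇ g (τ (suc (i + t))))) d
      ≡⟨ cong (aboveᵢ-before + bit (g i <ᵇ g j) +_) inside ⟩
    aboveᵢ-before + bit (g i <ᵇ g j) + aboveᵢ-mid ∎
    where
    open ≡-Reasoning
    before : count (λ x → g i <ᵇ g (τ x)) i ≡ aboveᵢ-before
    before = sumTo-cong i (λ x x<i → cong (λ z → bit (g i <ᵇ g z)) (transp-fix-below i j x x<i i<j))
    inside : sumTo (λ t → bit (g i <ᵇ g (τ (suc (i + t))))) d ≡ aboveᵢ-mid
    inside = sumTo-cong d (λ t t<d → cong (λ z → bit (g i <ᵇ g z)) (transp-fix-between i j _ (after i t) (within i t<d)))

  at-j-before : f j ≡ aboveⱼ-before + bit (g j <ᵇ g i) + aboveⱼ-mid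
  at-j-before = sumTo-split (λ x → bit (g j <ᵇ g x)) i d

  -- A position y strictly between i and j sees g j in place of g i.
  at-mid : ∀ t → t < d →
    f' (suc (i + t)) + bit (g (suc (i + t)) <ᵇ g i) ≡ f (suc (i + t)) + bit (g (suc (i + t)) <ᵇ g j)
  at-mid t t<d = begin
    f' y + bit (g y <ᵇ g i)           ≡⟨ cong (_+ bit (g y <ᵇ g i)) after' ⟩
    c + bit (g y <ᵇ g j) + R + bit (g y <ᵇ g i) ≡⟨ swap c (bit (g y <ᵇ g j)) R (bit (g y <ᵇ g i)) ⟩
    c + bit (g y <ᵇ g i) + R + bit (g y <ᵇ g j) ≡⟨ cong (_+ bit (g y <ᵇ g j)) (sym (sumTo-split (λ x → bit (g y <ᵇ g x)) i t)) ⟩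
    f y + bit (g y <ᵇ g j) ∎
    where
    open ≡-Reasoning
    y : ℕ
    y = suc (i + t)
    c : ℕ
    c = count (λ x → g y <ᵇ g x) i
    R : ℕ
    R = sumTo (λ t' → bit (g y <ᵇ g (suc (i + t')))) t
    swap : ∀ a b c d → a + b + c + d ≡ a + d + c + b
    swap = solve-∀
    after' : f' y ≡ c + bit (g y <ᵇ g j) + R
    after' = begin
      count (λ x → g (τ y) <ᵇ g (τ x)) y
        ≡⟨ cong (λ z → count (λ x → g z <ᵇ g (τ x)) y) (transp-fix-between i j y (after i t) (within i t<d)) ⟩
      count (λ x → g y <ᵇ g (τ x)) y
        ≡⟨ sumTo-split (λ x → bit (g y <ᵇ g (τ x))) i t ⟩
      count (λ x → g y <ᵇ g (τ x)) i + bit (g y <ᵇ g (τ i)) + sumTo (λ t' → bit (g y <ᵇ g (τ (suc (i + t'))))) t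
        ≡⟨ cong₂ (λ a b → a + b + sumTo (λ t' → bit (g y <ᵇ g (τ (suc (i + t'))))) t)
                 (sumTo-cong i (λ x x<i → cong (λ z → bit (g y <ᵇ g z)) (transp-fix-below i j x x<i i<j)))
                                     (cong (λ z → bit (g y <ᵇ g z)) (transp-a i j)) ⟩
      c + bit (g y <ᵇ g j) + sumTo (λ t' → bit (g y <ᵇ g (τ (suc (i + t'))))) t
        ≡⟨ cong (c + bit (g y <ᵇ g j) +_) (sumTo-cong t (λ t' t'<t → cong (λ z → bit (g y <ᵇ g z))
             (transp-fix-between i j _ (after i t') (within i (<-trans t'<t t<d))))) ⟩
      c + bit (g y <ᵇ g j) + R ∎

  middle : mid' + belowᵢ-mid ≡ mid + belowⱼ-mid
  middle = trans (sym (sumTo-distrib _ _ d)) (trans (sumTo-cong d at-mid) (sumTo-distrib _ _ d))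

  comparisons : g i < g j → aboveᵢ-mid + belowⱼ-mid ≡ aboveⱼ-mid + belowᵢ-mid + (Between + Between)
  comparisons gi<gj = trans (sym (sumTo-distrib _ _ d))
    (trans (sumTo-cong d (λ t t<d → between-bits (g i) (g j) (g (suc (i + t))) gi<gj
              (λ e → <-irrefl (sym (inj e)) (after i t)) (λ e → <-irrefl (inj e) (within i t<d))))
    (trans (sumTo-distrib _ _ d) (cong₂ _+_ (sumTo-distrib _ _ d) (sumTo-distrib _ _ d))))

  combine : ∀ lo aᵢ aⱼ m m' A A' H bᵢ bⱼ B → m' + bᵢ ≡ m + bⱼ → A + bⱼ ≡ A' + bᵢ + (B + B) →
    lo + aⱼ + m' + (aᵢ + 1 + A) + H ≡ lo + aᵢ + m + (aⱼ + 0 + A') + H + 1 + (B + B)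
  combine lo aᵢ aⱼ m m' A A' H bᵢ bⱼ B e₁ e₂ = +-cancelʳ-≡ (bᵢ + bⱼ) _ _ (begin
    lo + aⱼ + m' + (aᵢ + 1 + A) + H + (bᵢ + bⱼ)          ≡⟨ regroup₁ lo aᵢ aⱼ m' A H bᵢ bⱼ ⟩
    (lo + aⱼ + aᵢ + 1 + H) + (m' + bᵢ) + (A + bⱼ)        ≡⟨ cong₂ (λ a b → (lo + aⱼ + aᵢ + 1 + H) + a + b) e₁ e₂ ⟩
    (lo + aⱼ + aᵢ + 1 + H) + (m + bⱼ) + (A' + bᵢ + (B + B)) ≡⟨ regroup₂ lo aᵢ aⱼ m A' H bᵢ bⱼ B ⟩
    lo + aᵢ + m + (aⱼ + 0 + A') + H + 1 + (B + B) + (bᵢ + bⱼ) ∎)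
    where
    open ≡-Reasoning
    regroup₁ : ∀ lo aᵢ aⱼ m' A H bᵢ bⱼ →
      lo + aⱼ + m' + (aᵢ + 1 + A) + H + (bᵢ + bⱼ) ≡ (lo + aⱼ + aᵢ + 1 + H) + (m' + bᵢ) + (A + bⱼ)
    regroup₁ = solve-∀
    regroup₂ : ∀ lo aᵢ aⱼ m A' H bᵢ bⱼ B →
      (lo + aⱼ + aᵢ + 1 + H) + (m + bⱼ) + (A' + bᵢ + (B + B)) ≡ lo + aᵢ + m + (aⱼ + 0 + A') + H + 1 + (B + B) + (bᵢ + bⱼ)
    regroup₂ = solve-∀

  inversions-up : g i < g j → inversions g' N ≡ inversions g N + 1 + (Between + Between)
  inversions-up gi<gj = begin
    inversions g' N
      ≡⟨ sumTo-split₂ f' i d e ⟩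
    sumTo f' i + f' i + mid' + f' j + sumTo (λ t → f' (suc (j + t))) e
      ≡⟨ cong₂ (λ a b → a + f' i + mid' + f' j + b) before-i after-j ⟩
    sumTo f i + f' i + mid' + f' j + high
      ≡⟨ cong₂ (λ a b → sumTo f i + a + mid' + b + high) at-i (trans at-j (cong (λ z → aboveᵢ-before + z + aboveᵢ-mid) (bit-< gi<gj))) ⟩
    sumTo f i + aboveⱼ-before + mid' + (aboveᵢ-before + 1 + aboveᵢ-mid) + high
      ≡⟨ combine (sumTo f i) aboveᵢ-before aboveⱼ-before mid mid' aboveᵢ-mid aboveⱼ-mid high belowᵢ-mid belowⱼ-mid Between
                 middle (comparisons gi<gj) ⟩
    sumTo f i + aboveᵢ-before + mid + (aboveⱼ-before + 0 + aboveⱼ-mid) + high + 1 + (Between + Between)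
      ≡⟨ cong (λ z → sumTo f i + aboveᵢ-before + mid + z + high + 1 + (Between + Between))
              (sym (trans at-j-before (cong (λ z → aboveⱼ-before + z + aboveⱼ-mid) (bit-≮ (<⇒≯ gi<gj))))) ⟩
    sumTo f i + f i + mid + f j + high + 1 + (Between + Between)
      ≡⟨ cong (λ z → z + 1 + (Between + Between)) (sym (sumTo-split₂ f i d e)) ⟩
    inversions g N + 1 + (Between + Between) ∎
    where open ≡-Reasoning

  no-between : Between ≡ 0 → ∀ u → i < u → u < j → g i < g u → g u < g j → ⊥
  no-between B≡0 u i<u u<j gi<gu gu<gj with m≤n⇒∃[o]m+o≡n i<u
  ... | t , refl = 0≢1+n (trans (sym (sumTo≡0 _ d B≡0 t (+-cancelˡ-< (suc i) t d u<j)))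
                                (cong bit (cong₂ _∧_ (<ᵇ-true gi<gu) (<ᵇ-true gu<gj))))

inversions-transp-up : ∀ (g : ℕ → ℕ) → Injective _≡_ _≡_ g → ∀ i j N → i < j → j < N → g i < g j →
  Σ ℕ λ B → inversions (λ x → g (transp i j x)) N ≡ inversions g N + 1 + (B + B)
          × (B ≡ 0 → ∀ u → i < u → u < j → g i < g u → g u < g j → ⊥)
inversions-transp-up g inj i j N i<j j<N gi<gj with m≤n⇒∃[o]m+o≡n i<j | m≤n⇒∃[o]m+o≡n j<N
... | d , refl | e , refl = Between , inversions-up gi<gj , no-between
  where open TranspositionInversions g inj i d e

inversions-transp-down : ∀ (g : ℕ → ℕ) → Injective _≡_ _≡_ g → ∀ i j N → i < j → j < N → g j < g i →
  Σ ℕ λ B → inversions g N ≡ inversions (λ x → g (transp i j x)) N + 1 + (B + B)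
inversions-transp-down g inj i j N i<j j<N gj<gi
  with inversions-transp-up (λ x → g (transp i j x)) (inj-transp g i j inj) i j N i<j j<N
         (subst₂ _<_ (cong g (sym (transp-a i j))) (cong g (sym (transp-b i j))) gj<gi)
... | B , eq , _ = B , trans (inversions-cong N (λ x → cong g (sym (transp-involutive i j x)))) eq

inversions-sₚ-up : ∀ (g : ℕ → ℕ) → Injective _≡_ _≡_ g → ∀ a N → suc a < N → g a < g (suc a) →
  inversions (λ x → g (sₚ a x)) N ≡ inversions g N + 1
inversions-sₚ-up g inj a N a+1<N ga<ga+1 with m≤n⇒∃[o]m+o≡n a+1<N
... | e , refl = subst Gains (+-identityʳ a)
  (trans (inversions-up (subst (λ z → g a < g (suc z)) (sym (+-identityʳ a)) ga<ga+1)) (+-identityʳ _))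
  where
  open TranspositionInversions g inj a 0 e
  Gains : ℕ → Set
  Gains b = inversions (λ x → g (transp a (suc b) x)) (suc (suc b + e)) ≡ inversions g (suc (suc b + e)) + 1

inversions-sₚ-down : ∀ (g : ℕ → ℕ) → Injective _≡_ _≡_ g → ∀ a N → suc a < N → g (suc a) < g a →
  inversions g N ≡ inversions (λ x → g (sₚ a x)) N + 1
inversions-sₚ-down g inj a N a+1<N lt =
  trans (inversions-cong N (λ x → cong g (sym (transp-involutive a (suc a) x))))
        (inversions-sₚ-up (λ x → g (sₚ a x)) (inj-transp g a (suc a) inj) a N a+1<N
          (subst₂ _<_ (cong g (sym (transp-a a (suc a)))) (cong g (sym (transp-b a (suc a)))) lt))

-- the letters of w are < n, so evalW w permutes {1, …, n}
Bounded : ℕ → List ℕ → Set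
Bounded n w = All (λ a → suc a ≤ n) w

evalW-∷ʳ : ∀ u a x → evalW (u ∷ʳ a) x ≡ evalW u (sₚ a x)
evalW-∷ʳ []      a x = refl
evalW-∷ʳ (b ∷ u) a x = cong (sₚ b) (evalW-∷ʳ u a x)

length-∷ʳ : ∀ (u : List ℕ) a → length (u ∷ʳ a) ≡ suc (length u)
length-∷ʳ u a = trans (length-++ u) (+-comm (length u) 1)

evalInv : List ℕ → ℕ → ℕ
evalInv []      x = x
evalInv (a ∷ w) x = evalInv w (sₚ a x)

evalInv-∷ʳ : ∀ u a x → evalInv (u ∷ʳ a) x ≡ sₚ a (evalInv u x)
evalInv-∷ʳ []      a x = refl
evalInv-∷ʳ (b ∷ u) a x = evalInv-∷ʳ u a (sₚ b x)

evalInv-evalW : ∀ w x → evalInv w (evalW w x) ≡ x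
evalInv-evalW []      x = refl
evalInv-evalW (a ∷ w) x = trans (cong (evalInv w) (transp-involutive a (suc a) (evalW w x))) (evalInv-evalW w x)

evalW-evalInv : ∀ w x → evalW w (evalInv w x) ≡ x
evalW-evalInv []      x = refl
evalW-evalInv (a ∷ w) x = trans (cong (sₚ a) (evalW-evalInv w (sₚ a x))) (transp-involutive a (suc a) x)

evalW-injective : ∀ w → Injective _≡_ _≡_ (evalW w)
evalW-injective w {x} {y} e = trans (sym (evalInv-evalW w x)) (trans (cong (evalInv w) e) (evalInv-evalW w y))

sₚ-fixes-0 : ∀ a → 1 ≤ a → sₚ a 0 ≡ 0
sₚ-fixes-0 a 1≤a = transp-other a (suc a) 0 (λ e → <-irrefl e 1≤a) (λ ())

evalW-fixes-0 : ∀ w → Word w → evalW w 0 ≡ 0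
evalW-fixes-0 []      _        = refl
evalW-fixes-0 (a ∷ w) (p ∷ ps) = trans (cong (sₚ a) (evalW-fixes-0 w ps)) (sₚ-fixes-0 a p)

-- Coxeter length equals the number of inversions.

inversions-sₚ≤ : ∀ (g : ℕ → ℕ) → Injective _≡_ _≡_ g → ∀ a N → suc a < N →
  inversions (λ x → g (sₚ a x)) N ≤ inversions g N + 1
inversions-sₚ≤ g inj a N a+1<N with <-cmp (g a) (g (suc a))
... | tri< lt _ _ = ≤-reflexive (inversions-sₚ-up g inj a N a+1<N lt)
... | tri≈ _ e _  = ⊥-elim (<-irrefl (inj e) (n<1+n a))
... | tri> _ _ gt = ≤-trans (m≤m+n _ 1) (≤-trans (≤-reflexive (sym (inversions-sₚ-down g inj a N a+1<N gt))) (m≤m+n _ 1))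

-- each letter creates at most one inversion
inversions≤length : ∀ n v → Bounded n v → inversions (evalW v) (suc n) ≤ length v
inversions≤length n v = go (reverseView v)
  where
  go : ∀ {v} → Reverse v → Bounded n v → inversions (evalW v) (suc n) ≤ length v
  go [] _ = ≤-reflexive (trans (sumTo-cong (suc n) (λ y _ → none y)) (sumTo-zeros (suc n)))
    where
    none : ∀ y → count (λ x → y <ᵇ x) y ≡ 0
    none y = trans (sumTo-cong y (λ x x<y → bit-≮ (<⇒≯ x<y))) (sumTo-zeros y)
  go (u ∶ r ∶ʳ a) bnd with ∷ʳ⁻ bnd
  ... | bu , ba = begin
    inversions (evalW (u ∷ʳ a)) (suc n)           ≡⟨ inversions-cong (suc n) (evalW-∷ʳ u a) ⟩
    inversions (λ x → evalW u (sₚ a x)) (suc n)   ≤⟨ inversions-sₚ≤ (evalW u) (evalW-injective u) a (suc n) (s≤s ba) ⟩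
    inversions (evalW u) (suc n) + 1              ≤⟨ +-monoˡ-≤ 1 (go r bu) ⟩
    length u + 1                                  ≡⟨ trans (+-comm (length u) 1) (sym (length-∷ʳ u a)) ⟩
    length (u ∷ʳ a) ∎
    where open ≤-Reasoning

record PermOn (n : ℕ) (g : ℕ → ℕ) : Set where
  field
    injective   : Injective _≡_ _≡_ g
    fixes-above : ∀ x → n < x → g x ≡ x
    fixes-zero  : g 0 ≡ 0
    in-range    : ∀ x → 1 ≤ x → x ≤ n → 1 ≤ g x × g x ≤ n
open PermOn

sₚ-in-range : ∀ n a → 1 ≤ a → suc a ≤ n → ∀ x → 1 ≤ x → x ≤ n → 1 ≤ sₚ a x × sₚ a x ≤ n
sₚ-in-range n a 1≤a a<n x 1≤x x≤n with transpCase a (suc a) x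
... | at-a _ eq   rewrite eq = s≤s z≤n , a<n
... | at-b _ _ eq rewrite eq = 1≤a , ≤-trans (n≤1+n a) a<n
... | other _ _ eq rewrite eq = 1≤x , x≤n

sₚ-fixes-above : ∀ n a → suc a ≤ n → ∀ x → n < x → sₚ a x ≡ x
sₚ-fixes-above n a a<n x n<x =
  transp-other a (suc a) x (λ e → <-irrefl (sym e) (<-trans a<n n<x)) (λ e → <-irrefl (sym e) (≤-<-trans a<n n<x))

permOn-∘sₚ : ∀ n g a → PermOn n g → 1 ≤ a → suc a ≤ n → PermOn n (λ x → g (sₚ a x))
permOn-∘sₚ n g a P 1≤a a<n = record
  { injective   = inj-transp g a (suc a) (injective P)
  ; fixes-above = λ x n<x → trans (cong g (sₚ-fixes-above n a a<n x n<x)) (fixes-above P x n<x)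
  ; fixes-zero  = trans (cong g (sₚ-fixes-0 a 1≤a)) (fixes-zero P)
  ; in-range    = λ x p q → let (p' , q') = sₚ-in-range n a 1≤a a<n x p q in in-range P (sₚ a x) p' q' }

permOn-sₚ∘ : ∀ n g a → PermOn n g → 1 ≤ a → suc a ≤ n → PermOn n (λ x → sₚ a (g x))
permOn-sₚ∘ n g a P 1≤a a<n = record
  { injective   = λ {x} {y} e → injective P (trans (sym (transp-involutive a (suc a) (g x)))
                                  (trans (cong (sₚ a) e) (transp-involutive a (suc a) (g y))))
  ; fixes-above = λ x n<x → trans (cong (sₚ a) (fixes-above P x n<x)) (sₚ-fixes-above n a a<n x n<x)
  ; fixes-zero  = trans (cong (sₚ a) (fixes-zero P)) (sₚ-fixes-0 a 1≤a)
  ; in-range    = λ x p q → let (p' , q') = in-range P x p q in sₚ-in-range n a 1≤a a<n (g x) p' q' }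

evalW-permOn : ∀ n w → Word w → Bounded n w → PermOn n (evalW w)
evalW-permOn n []      _        _        = record
  { injective = λ e → e ; fixes-above = λ _ _ → refl ; fixes-zero = refl ; in-range = λ _ p q → p , q }
evalW-permOn n (a ∷ w) (p ∷ ps) (q ∷ qs) = permOn-sₚ∘ n (evalW w) a (evalW-permOn n w ps qs) p q

descent-or-ascending : ∀ (g : ℕ → ℕ) n → (Σ ℕ λ a → 1 ≤ a × suc a ≤ n × g (suc a) < g a)
                                        ⊎ (∀ a → 1 ≤ a → suc a ≤ n → ¬ (g (suc a) < g a))
descent-or-ascending g zero = inj₂ (λ a _ ())
descent-or-ascending g (suc m) with descent-or-ascending g m
... | inj₁ (a , p , q , r) = inj₁ (a , p , m≤n⇒m≤1+n q , r)
... | inj₂ asc with m | g (suc m) <? g m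
...   | zero   | _         = inj₂ (λ { (suc a) p (s≤s ()) ; zero () _ })
...   | suc m' | yes desc  = inj₁ (suc m' , s≤s z≤n , ≤-refl , desc)
...   | suc m' | no ¬desc  = inj₂ extend
  where
  extend : ∀ a → 1 ≤ a → suc a ≤ suc (suc m') → ¬ (g (suc a) < g a)
  extend a p q with suc a ≤? suc m'
  ... | yes q' = asc a p q'
  ... | no q' with ≤-antisym (≤-pred q) (≤-pred (≰⇒> q'))
  ... | refl = ¬desc

module Ascending (n : ℕ) (g : ℕ → ℕ) (P : PermOn n g) (no-descent : ∀ a → 1 ≤ a → suc a ≤ n → ¬ (g (suc a) < g a)) where
  ascent : ∀ a → 1 ≤ a → suc a ≤ n → g a < g (suc a)
  ascent a p q with <-cmp (g a) (g (suc a))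
  ... | tri< lt _ _ = lt
  ... | tri≈ _ e _  = ⊥-elim (<-irrefl (injective P e) (n<1+n a))
  ... | tri> _ _ gt = ⊥-elim (no-descent a p q gt)

  increasing : ∀ x y → 1 ≤ x → x < y → y ≤ n → g x < g y
  increasing x (suc y) 1≤x x<y y≤n with x ≟ y
  ... | yes refl = ascent x 1≤x y≤n
  ... | no x≢y   = <-trans (increasing x y 1≤x (≤∧≢⇒< (≤-pred x<y) x≢y) (≤-trans (n≤1+n y) y≤n))
                           (ascent y (≤-trans 1≤x (≤-pred x<y)) y≤n)

  at-least : ∀ x → 1 ≤ x → x ≤ n → x ≤ g x
  at-least (suc zero)    _ q = proj₁ (in-range P 1 (s≤s z≤n) q)
  at-least (suc (suc x)) _ q = ≤-trans (s≤s (at-least (suc x) (s≤s z≤n) (≤-trans (n≤1+n _) q))) (ascent (suc x) (s≤s z≤n) q)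

  room-above : ∀ m x → x + m ≡ n → 1 ≤ x → g x + m ≤ n
  room-above zero    x e p = ≤-trans (≤-reflexive (+-identityʳ (g x))) (proj₂ (in-range P x p (≤-trans (m≤m+n x 0) (≤-reflexive e))))
  room-above (suc m) x e p = begin
    g x + suc m     ≡⟨ +-suc (g x) m ⟩
    suc (g x) + m   ≤⟨ +-monoˡ-≤ m (ascent x p x<n) ⟩
    g (suc x) + m   ≤⟨ room-above m (suc x) (trans (sym (+-suc x m)) e) (s≤s z≤n) ⟩
    n ∎
    where
    open ≤-Reasoning
    x<n : suc x ≤ n
    x<n = ≤-trans (s≤s (m≤m+n x m)) (≤-reflexive (trans (sym (+-suc x m)) e))

  identity : ∀ x → x ≡ g x
  identity zero = sym (fixes-zero P)
  identity (suc x) with suc x ≤? n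
  ... | no x≰n = sym (fixes-above P (suc x) (≰⇒> x≰n))
  ... | yes x≤n with m≤n⇒∃[o]m+o≡n x≤n
  ... | m , e = ≤-antisym (at-least (suc x) (s≤s z≤n) x≤n)
                          (+-cancelʳ-≤ m (g (suc x)) (suc x) (≤-trans (room-above m (suc x) e (s≤s z≤n)) (≤-reflexive (sym e))))

  no-inversions : inversions g (suc n) ≡ 0
  no-inversions = trans (sumTo-cong (suc n) (λ y y≤n → trans (sumTo-cong y (λ x x<y → in-order y x x<y (≤-pred y≤n))) (sumTo-zeros y)))
                        (sumTo-zeros (suc n))
    where
    in-order : ∀ y x → x < y → y ≤ n → bit (g y <ᵇ g x) ≡ 0
    in-order y zero    _   _   rewrite fixes-zero P = bit-≮ {g y} {0} (λ ())
    in-order y (suc x) x<y y≤n = bit-≮ (<⇒≯ (increasing (suc x) y (s≤s z≤n) x<y y≤n))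

-- A permutation of {1, …, n} with k inversions is a word of length k:
-- peel off a descent, which removes exactly one inversion.
word-of-inversions : ∀ n k g → PermOn n g → inversions g (suc n) ≡ k →
  Σ (List ℕ) λ v → Word v × Bounded n v × (∀ x → evalW v x ≡ g x) × length v ≡ k
word-of-inversions n k g P e with descent-or-ascending g n
word-of-inversions n zero    g P e | inj₂ asc = [] , [] , [] , Ascending.identity n g P asc , refl
word-of-inversions n (suc k) g P e | inj₂ asc = ⊥-elim (0≢1+n (trans (sym (Ascending.no-inversions n g P asc)) e))
word-of-inversions n k g P e | inj₁ (a , p , q , desc) with inversions-sₚ-down g (injective P) a (suc n) (s≤s q) desc
word-of-inversions n zero    g P e | inj₁ _ | drop = ⊥-elim (1+n≢0 (trans (+-comm 1 _) (trans (sym drop) e)))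
word-of-inversions n (suc k) g P e | inj₁ (a , p , q , desc) | drop
  with word-of-inversions n k (λ x → g (sₚ a x)) (permOn-∘sₚ n g a P p q)
         (suc-injective (trans (+-comm 1 _) (trans (sym drop) e)))
... | v , wv , bv , ev , lv =
  v ∷ʳ a , ∷ʳ⁺ wv p , ∷ʳ⁺ bv q ,
  (λ x → trans (evalW-∷ʳ v a x) (trans (ev (sₚ a x)) (cong g (transp-involutive a (suc a) x)))) ,
  trans (length-∷ʳ v a) (cong suc lv)

reduced-length : ∀ n w f → ReducedWordFor w f → Bounded n w → length w ≡ inversions (evalW w) (suc n)
reduced-length n w f ((ww , ef) , minimal) bw = ≤-antisym shortest (inversions≤length n w bw)
  where
  shortest : length w ≤ inversions (evalW w) (suc n)
  shortest with word-of-inversions n _ (evalW w) (evalW-permOn n w ww bw) refl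
  ... | v , wv , _ , ev , lv = subst (length w ≤_) lv (minimal v (wv , λ x → trans (ev x) (ef x)))

-- The code of a permutation and the tower diagram it describes.

countAbove : (ℕ → ℕ) → ℕ → ℕ → ℕ
countAbove ω k v = count (λ u → k <ᵇ ω u) v

-- code ω π p = #{u < π p ∣ ω u ≥ p}: the height of the p-th tower of ω (π = ω⁻¹)
code : (ℕ → ℕ) → (ℕ → ℕ) → ℕ → ℕ
code ω π p = countAbove ω (p ∸ 1) (π p)

code-cong : ∀ {ω ω' π π'} → (∀ x → ω x ≡ ω' x) → (∀ x → π x ≡ π' x) → ∀ p → code ω π p ≡ code ω' π' p
code-cong {ω} {ω'} {π} {π'} eω eπ p =
  trans (cong (countAbove ω (p ∸ 1)) (eπ p)) (sumTo-cong (π' p) (λ u _ → cong (λ z → bit ((p ∸ 1) <ᵇ z)) (eω u)))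

HasCode : Tower → (ℕ → ℕ) → (ℕ → ℕ) → Set
HasCode T ω π = ∀ k → ht T (suc k) ≡ code ω π (suc k)

code-at : ∀ {T ω π} → HasCode T ω π → ∀ p → 1 ≤ p → ht T p ≡ code ω π p
code-at hT (suc p) _ = hT p

bit-<-suc : ∀ k m → bit (k <ᵇ m) ≡ bit (suc k <ᵇ m) + bit (m ≡ᵇ suc k)
bit-<-suc k m with <-cmp (suc k) m
... | tri< k+1<m _ _
  rewrite <ᵇ-true (<-trans (n<1+n k) k+1<m) | <ᵇ-true k+1<m | ≡ᵇ-false (λ e → <-irrefl (sym e) k+1<m) = refl
... | tri≈ _ refl _
  rewrite <ᵇ-true (n<1+n k) | <ᵇ-false (<-irrefl (refl {x = suc k})) | ≡ᵇ-true (refl {x = suc k}) = refl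
... | tri> _ m≢k+1 m<k+1
  rewrite <ᵇ-false (≤⇒≯ (≤-pred m<k+1)) | <ᵇ-false (<⇒≯ m<k+1) | ≡ᵇ-false (λ e → m≢k+1 (sym e)) = refl

slideAux-pass : ∀ p s h U → p + h < s → slideAux p s (h ∷ U) ≡ h ∷ slideAux (suc p) s U
slideAux-pass p s h U lt rewrite <ᵇ-true lt = refl

slideAux-grow : ∀ p s h U → s ≡ p + h → slideAux p s (h ∷ U) ≡ suc h ∷ U
slideAux-grow p s h U e rewrite <ᵇ-false (λ lt → <-irrefl (sym e) lt) | ≡ᵇ-true e = refl

slideAux-shift : ∀ p s h U → 0 < h → suc s < p + h → slideAux p s (h ∷ U) ≡ h ∷ slideAux (suc p) (suc s) U
slideAux-shift p s h U 0<h lt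
  rewrite <ᵇ-false (<⇒≯ (<-trans (n<1+n s) lt)) | ≡ᵇ-false (λ e → <-irrefl e (<-trans (n<1+n s) lt))
        | <ᵇ-true 0<h | ≡ᵇ-false (λ e → <-irrefl e lt) = refl

ht-new-cell : ∀ m k → ht (replicate m 0 ++ [ 1 ]) (suc k) ≡ bit (k ≡ᵇ m)
ht-new-cell zero    zero    = refl
ht-new-cell zero    (suc k) = refl
ht-new-cell (suc m) zero    = refl
ht-new-cell (suc m) (suc k) = ht-new-cell m k

≡ᵇ-+ : ∀ k r c → (k ≡ᵇ r) ≡ (k + c ≡ᵇ r + c)
≡ᵇ-+ k r c with k ≟ r
... | yes refl = trans (≡ᵇ-true (refl {x = k})) (sym (≡ᵇ-true (refl {x = k + c})))
... | no k≢r   = trans (≡ᵇ-false k≢r) (sym (≡ᵇ-false (λ e → k≢r (+-cancelʳ-≡ c k r e))))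

countAbove-transp-below : ∀ ω i j k v → i < j → v ≤ i →
  countAbove (λ u → ω (transp i j u)) k v ≡ countAbove ω k v
countAbove-transp-below ω i j k v i<j v≤i =
  sumTo-cong v (λ u u<v → cong (λ z → bit (k <ᵇ ω z)) (transp-fix-below i j u (<-≤-trans u<v v≤i) i<j))

module Code (ω π : ℕ → ℕ) (ωπ : ∀ x → ω (π x) ≡ x) (πω : ∀ x → π (ω x) ≡ x) (ω0 : ω 0 ≡ 0) where
  C : ℕ → ℕ → ℕ
  C = countAbove ω
  H : ℕ → ℕ
  H = code ω π

  ω-injective : Injective _≡_ _≡_ ω
  ω-injective {x} {y} e = trans (sym (πω x)) (trans (cong π e) (πω y))

  ω-positive : ∀ x → 1 ≤ x → 1 ≤ ω x
  ω-positive (suc x) _ with ω (suc x) in eq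
  ... | zero  = ⊥-elim (1+n≢0 (ω-injective (trans eq (sym ω0))))
  ... | suc _ = s≤s z≤n

  position-count : ∀ c v → count (λ u → ω u ≡ᵇ c) v ≡ bit (π c <ᵇ v)
  position-count c zero    = refl
  position-count c (suc v) with π c ≟ v
  ... | yes πc≡v = begin
    count (λ u → ω u ≡ᵇ c) v + bit (ω v ≡ᵇ c) ≡⟨ cong₂ _+_ (position-count c v) (cong bit (≡ᵇ-true ωv≡c)) ⟩
    bit (π c <ᵇ v) + 1                        ≡⟨ cong (λ z → bit z + 1) (<ᵇ-false (<-irrefl πc≡v)) ⟩
    1                                         ≡⟨ cong bit (sym (<ᵇ-true (s≤s (≤-reflexive πc≡v)))) ⟩
    bit (π c <ᵇ suc v) ∎
    where
    open ≡-Reasoning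
    ωv≡c : ω v ≡ c
    ωv≡c = trans (cong ω (sym πc≡v)) (ωπ c)
  ... | no πc≢v  = begin
    count (λ u → ω u ≡ᵇ c) v + bit (ω v ≡ᵇ c) ≡⟨ cong₂ _+_ (position-count c v) (cong bit (≡ᵇ-false ωv≢c)) ⟩
    bit (π c <ᵇ v) + 0                        ≡⟨ +-identityʳ _ ⟩
    bit (π c <ᵇ v)                            ≡⟨ cong bit (<ᵇ-cong (λ p → m<n⇒m<1+n p) (λ p → ≤∧≢⇒< (≤-pred p) πc≢v)) ⟩
    bit (π c <ᵇ suc v) ∎
    where
    open ≡-Reasoning
    ωv≢c : ω v ≢ c
    ωv≢c e = πc≢v (trans (cong π (sym e)) (πω v))

  threshold-step : ∀ k v → C k v ≡ C (suc k) v + bit (π (suc k) <ᵇ v)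
  threshold-step k v = begin
    C k v                                                   ≡⟨ sumTo-cong v (λ u _ → bit-<-suc k (ω u)) ⟩
    sumTo (λ u → bit (suc k <ᵇ ω u) + bit (ω u ≡ᵇ suc k)) v ≡⟨ sumTo-distrib _ _ v ⟩
    C (suc k) v + count (λ u → ω u ≡ᵇ suc k) v             ≡⟨ cong (C (suc k) v +_) (position-count (suc k) v) ⟩
    C (suc k) v + bit (π (suc k) <ᵇ v) ∎
    where open ≡-Reasoning

  -- every position u ≥ 1 has ω u > 0
  countAbove-0 : ∀ b → C 0 (suc b) ≡ b
  countAbove-0 zero    = cong bit (cong (0 <ᵇ_) ω0)
  countAbove-0 (suc b) = trans (cong₂ _+_ (countAbove-0 b) (bit-< (ω-positive (suc b) (s≤s z≤n)))) (+-comm b 1)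

  countAbove-mono : ∀ k {v v'} → v ≤ v' → C k v ≤ C k v'
  countAbove-mono k = sumTo-mono _

  countAbove-strict : ∀ k {v v'} → k < ω v → v < v' → C k v < C k v'
  countAbove-strict k {v} k<ωv v<v' =
    ≤-trans (≤-reflexive (trans (+-comm 1 (C k v)) (cong (C k v +_) (sym (bit-< k<ωv))))) (countAbove-mono k v<v')

  countAbove-reflects-< : ∀ k {v v'} → C k v < C k v' → v < v'
  countAbove-reflects-< k {v} {v'} lt with v <? v'
  ... | yes v<v' = v<v'
  ... | no v≮v'  = ⊥-elim (<⇒≱ lt (countAbove-mono k (≮⇒≥ v≮v')))

  countAbove-injective : ∀ k {v v'} → k < ω v → k < ω v' → C k v ≡ C k v' → v ≡ v'
  countAbove-injective k {v} {v'} k<ωv k<ωv' e with <-cmp v v'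
  ... | tri< lt _ _ = ⊥-elim (<-irrefl e (countAbove-strict k k<ωv lt))
  ... | tri≈ _ eq _ = eq
  ... | tri> _ _ gt = ⊥-elim (<-irrefl (sym e) (countAbove-strict k k<ωv' gt))

  below-value : ∀ k → k < ω (π (suc k))
  below-value k = subst (k <_) (sym (ωπ (suc k))) (n<1+n k)

  flight : ∀ T → HasCode T ω π → ∀ k b → k < ω (fnC T k b) × C k (fnC T k b) ≡ b
  flight T hT zero    b = ω-positive (suc b) (s≤s z≤n) , countAbove-0 b
  flight T hT (suc k) b = if-dec (λ v → suc k < ω v × C (suc k) v ≡ b) (b <? ht T (suc k)) under over
    where
    πk : ℕ
    πk = π (suc k)
    under : b < ht T (suc k) → suc k < ω (fnC T k b) × C (suc k) (fnC T k b) ≡ b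
    under b<h with flight T hT k b
    ... | k<ωv , Cv≡b = ≤∧≢⇒< k<ωv (λ e → <-irrefl (trans (sym (πω _)) (cong π (sym e))) v<πk) ,
      (begin
        C (suc k) v         ≡⟨ sym (+-identityʳ _) ⟩
        C (suc k) v + 0     ≡⟨ cong (C (suc k) v +_) (sym (bit-≮ (<⇒≯ v<πk))) ⟩
        C (suc k) v + bit (πk <ᵇ v) ≡⟨ sym (threshold-step k v) ⟩
        C k v               ≡⟨ Cv≡b ⟩
        b ∎)
      where
      open ≡-Reasoning
      v : ℕ
      v = fnC T k b
      v<πk : v < πk
      v<πk = countAbove-reflects-< k (subst₂ _<_ (sym Cv≡b) (hT k) b<h)
    over : ¬ b < ht T (suc k) → suc k < ω (fnC T k (suc b)) × C (suc k) (fnC T k (suc b)) ≡ b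
    over b≮h with flight T hT k (suc b)
    ... | k<ωv , Cv≡b+1 = ≤∧≢⇒< k<ωv (λ e → <-irrefl (trans (cong π e) (πω _)) πk<v) ,
      +-cancelʳ-≡ 1 _ _ (trans (cong (C (suc k) v +_) (sym (bit-< πk<v)))
                               (trans (sym (threshold-step k v)) (trans Cv≡b+1 (+-comm 1 b))))
      where
      v : ℕ
      v = fnC T k (suc b)
      πk<v : πk < v
      πk<v = countAbove-reflects-< k (subst (C k πk <_) (sym Cv≡b+1) (s≤s (subst (_≤ b) (hT k) (≮⇒≥ b≮h))))

  index≡π : ∀ T → HasCode T ω π → ∀ p → 1 ≤ p → index T p ≡ π p
  index≡π T hT (suc p) _ with flight T hT p (ht T (suc p))
  ... | p<ωv , Cv≡h = countAbove-injective p p<ωv (below-value p) (trans Cv≡h (hT p))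

  -- the first slide step starts at s = a = #{u < a ∣ ω u > 0} + 1
  slide-start : ∀ a → 1 ≤ a → a ≡ C 0 a + 1
  slide-start (suc b) _ = trans (+-comm 1 b) (cong (_+ 1) (sym (countAbove-0 b)))

  -- One slide.  If ω a < ω (a+1), sliding a into the diagram of ω yields the
  -- diagram of ω ∘ s_a, whose code exceeds that of ω by one at tower ω a.
  module Slide (a : ℕ) (1≤a : 1 ≤ a) (ascent : ω a < ω (suc a)) where
    x : ℕ
    x = ω a
    ω' : ℕ → ℕ
    ω' = λ u → ω (sₚ a u)
    π' : ℕ → ℕ
    π' = λ u → sₚ a (π u)

    ≢x : ∀ q → π (suc q) ≢ a → suc q ≢ x
    ≢x q ne e = ne (trans (cong π e) (πω a))

    end-of-diagram : ∀ r q → C q a ≡ r → suc q ≤ x → (∀ k → H (k + suc q) ≡ 0) → x ≡ r + suc q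
    end-of-diagram zero q e q<x empty
      with countAbove-injective q (below-value q) q<x (trans (empty 0) (sym e))
    ... | πq+1≡a = trans (cong ω (sym πq+1≡a)) (ωπ (suc q))
    end-of-diagram (suc r) q e q<x empty = trans (end-of-diagram r (suc q) e' q+1<x empty') (+-suc r (suc q))
      where
      before : π (suc q) < a
      before = countAbove-reflects-< q (subst₂ _<_ (sym (empty 0)) (sym e) (s≤s z≤n))
      e' : C (suc q) a ≡ r
      e' = suc-injective (trans (+-comm 1 _) (trans (cong (C (suc q) a +_) (sym (bit-< before)))
                                                    (trans (sym (threshold-step q a)) e)))
      q+1<x : suc (suc q) ≤ x
      q+1<x = ≤∧≢⇒< q<x (≢x q (λ eq → <-irrefl eq before))
      empty' : ∀ k → H (k + suc (suc q)) ≡ 0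
      empty' k = trans (cong H (+-suc k (suc q))) (empty (suc k))

    SlidFrom : List ℕ → ℕ → Set
    SlidFrom V q = ∀ k → ht V (suc k) ≡ H (k + suc q) + bit (k + suc q ≡ᵇ x)

    walk : ∀ U q s → (∀ k → ht U (suc k) ≡ H (k + suc q)) → s ≡ C q a + suc q → suc q ≤ x →
           SlidFrom (slideAux (suc q) s U) q

    passed : ∀ h U q s s' → (∀ k → ht (h ∷ U) (suc k) ≡ H (k + suc q)) →
             slideAux (suc q) s (h ∷ U) ≡ h ∷ slideAux (suc (suc q)) s' U →
             s' ≡ C (suc q) a + suc (suc q) → suc q ≢ x → suc q ≤ x → SlidFrom (slideAux (suc q) s (h ∷ U)) q
    passed h U q s s' hU step es' q+1≢x q<x zero rewrite step =
      trans (hU 0) (sym (trans (cong (λ z → H (suc q) + bit z) (≡ᵇ-false q+1≢x)) (+-identityʳ _)))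
    passed h U q s s' hU step es' q+1≢x q<x (suc k) rewrite step =
      trans (walk U (suc q) s' (λ k → trans (hU (suc k)) (cong H (sym (+-suc k (suc q))))) es' (≤∧≢⇒< q<x q+1≢x) k)
            (cong (λ z → H z + bit (z ≡ᵇ x)) (+-suc k (suc q)))

    walk [] q s hU refl q<x k = begin
      ht (replicate (C q a + suc q ∸ suc q) 0 ++ [ 1 ]) (suc k) ≡⟨ ht-new-cell _ k ⟩
      bit (k ≡ᵇ (C q a + suc q ∸ suc q))    ≡⟨ cong (λ z → bit (k ≡ᵇ z)) (m+n∸n≡m (C q a) (suc q)) ⟩
      bit (k ≡ᵇ C q a)                      ≡⟨ cong bit (≡ᵇ-+ k (C q a) (suc q)) ⟩
      bit (k + suc q ≡ᵇ C q a + suc q)      ≡⟨ cong (λ z → bit (k + suc q ≡ᵇ z)) (sym x≡) ⟩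
      bit (k + suc q ≡ᵇ x)                  ≡⟨ cong (_+ bit (k + suc q ≡ᵇ x)) (hU k) ⟩
      H (k + suc q) + bit (k + suc q ≡ᵇ x) ∎
      where
      open ≡-Reasoning
      x≡ : x ≡ C q a + suc q
      x≡ = end-of-diagram (C q a) q refl q<x (λ k → sym (hU k))
    walk (h ∷ U) q s hU refl q<x with <-cmp (π (suc q)) a
    -- value q+1 sits before a: the tower is lower than the slide, pass it
    ... | tri< before _ _ = passed h U q s s hU (slideAux-pass (suc q) s h U pass) es' (≢x q (λ e → <-irrefl e before)) q<x
      where
      h<r : h < C q a
      h<r = subst (_< C q a) (sym (hU 0)) (countAbove-strict q (below-value q) before)
      pass : suc q + h < s
      pass = subst (_< s) (+-comm h (suc q)) (+-monoˡ-< (suc q) h<r)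
      es' : s ≡ C (suc q) a + suc (suc q)
      es' = trans (cong (_+ suc q) (trans (threshold-step q a) (cong (C (suc q) a +_) (bit-< before))))
                  (+-assoc (C (suc q) a) 1 (suc q))
    -- value q+1 sits at a: this is tower x, which grows
    ... | tri≈ _ at _ = subst (λ V → SlidFrom V q) (sym (slideAux-grow (suc q) s h U s≡)) grown
      where
      h≡r : h ≡ C q a
      h≡r = trans (hU 0) (cong (C q) at)
      s≡ : s ≡ suc q + h
      s≡ = sym (trans (+-comm (suc q) h) (cong (_+ suc q) h≡r))
      q+1≡x : suc q ≡ x
      q+1≡x = trans (sym (ωπ (suc q))) (cong ω at)
      grown : SlidFrom (suc h ∷ U) q
      grown zero    = trans (+-comm 1 h) (cong₂ _+_ (hU 0) (sym (cong bit (≡ᵇ-true q+1≡x))))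
      grown (suc k) = trans (hU (suc k)) (sym (trans (cong (λ z → H (suc k + suc q) + bit z)
                        (≡ᵇ-false (λ z → m≢1+n+m (suc q) {k} (sym (trans z (sym q+1≡x)))))) (+-identityʳ _)))
    -- value q+1 sits beyond a+1: the tower is higher than the slide, shift past it
    ... | tri> _ _ after-a = passed h U q s (suc s) hU (slideAux-shift (suc q) s h U 0<h shift) es' (≢x q (λ e → <-irrefl (sym e) after-a)) q<x
      where
      r : ℕ
      r = C q a
      ≢a+1 : π (suc q) ≢ suc a
      ≢a+1 e = <-irrefl refl (<-≤-trans ascent (subst (_≤ ω a) (sym (trans (cong ω (sym e)) (ωπ (suc q)))) q<x))
      after-a+1 : suc a < π (suc q)
      after-a+1 = ≤∧≢⇒< after-a (λ e → ≢a+1 (sym e))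
      r+1<h : suc r < h
      r+1<h = subst₂ _<_ (trans (cong (r +_) (bit-< q<x)) (+-comm r 1)) (sym (hU 0))
                         (countAbove-strict q (<-trans q<x ascent) after-a+1)
      0<h : 0 < h
      0<h = <-≤-trans (s≤s z≤n) (<⇒≤ r+1<h)
      shift : suc s < suc q + h
      shift = subst (suc (r + suc q) <_) (+-comm h (suc q)) (+-monoˡ-< (suc q) r+1<h)
      es' : suc s ≡ C (suc q) a + suc (suc q)
      es' = trans (cong (λ z → suc (z + suc q)) (trans (threshold-step q a)
                    (trans (cong (C (suc q) a +_) (bit-≮ (<⇒≯ after-a))) (+-identityʳ _))))
                  (sym (+-suc (C (suc q) a) (suc q)))

    code-∘sₚ : ∀ q → code ω' π' (suc q) ≡ H (suc q) + bit (suc q ≡ᵇ x)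
    code-∘sₚ q with transpCase a (suc a) (π (suc q))
    ... | at-a at r = begin
        countAbove ω' q (π' (suc q))             ≡⟨ cong (countAbove ω' q) r ⟩
        countAbove ω' q a + bit (q <ᵇ ω (sₚ a a))
          ≡⟨ cong₂ (λ u v → u + bit (q <ᵇ ω v)) (countAbove-transp-below ω a (suc a) q a (n<1+n a) ≤-refl) (transp-a a (suc a)) ⟩
        C q a + bit (q <ᵇ ω (suc a))
          ≡⟨ cong₂ (λ u v → C q u + v) (sym at)
                   (trans (bit-< (<-trans (≤-reflexive q+1≡x) ascent)) (sym (cong bit (≡ᵇ-true q+1≡x)))) ⟩
        C q (π (suc q)) + bit (suc q ≡ᵇ x) ∎
      where
      open ≡-Reasoning
      q+1≡x : suc q ≡ x
      q+1≡x = trans (sym (ωπ (suc q))) (cong ω at)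
    ... | at-b at _ r = begin
        countAbove ω' q (π' (suc q)) ≡⟨ cong (countAbove ω' q) r ⟩
        countAbove ω' q a            ≡⟨ countAbove-transp-below ω a (suc a) q a (n<1+n a) ≤-refl ⟩
        C q a                        ≡⟨ sym (+-identityʳ _) ⟩
        C q a + 0                    ≡⟨ cong (C q a +_) (sym (bit-≮ (≤⇒≯ x≤q))) ⟩
        C q (suc a)                  ≡⟨ sym (+-identityʳ _) ⟩
        C q (suc a) + 0              ≡⟨ cong₂ (λ u v → C q u + v) (sym at) (sym (cong bit (≡ᵇ-false x≢q+1))) ⟩
        C q (π (suc q)) + bit (suc q ≡ᵇ x) ∎
      where
      open ≡-Reasoning
      x≤q : x ≤ q
      x≤q = ≤-pred (subst (x <_) (trans (cong ω (sym at)) (ωπ (suc q))) ascent)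
      x≢q+1 : suc q ≢ x
      x≢q+1 e = <-irrefl (sym e) (s≤s x≤q)
    ... | other ≢a ≢a+1 r = trans (cong (countAbove ω' q) r)
        (trans unchanged (sym (trans (cong (C q (π (suc q)) +_) (cong bit (≡ᵇ-false (≢x q ≢a)))) (+-identityʳ _))))
      where
      unchanged : countAbove ω' q (π (suc q)) ≡ C q (π (suc q))
      unchanged with <-cmp (π (suc q)) a
      ... | tri< lt _ _ = countAbove-transp-below ω a (suc a) q _ (n<1+n a) (<⇒≤ lt)
      ... | tri≈ _ eq _ = ⊥-elim (≢a eq)
      ... | tri> _ _ gt with m≤n⇒∃[o]m+o≡n (≤∧≢⇒< gt (λ z → ≢a+1 (sym z)))
      ...   | e , eq = subst (λ v → countAbove ω' q v ≡ C q v) eq (count-sₚ (λ u → q <ᵇ ω u) a e)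

    slide-code : ∀ T → HasCode T ω π → HasCode (slide a T) ω' π'
    slide-code T hT k = begin
      ht (slide a T) (suc k)             ≡⟨ walk T 0 a (λ k → trans (hT k) (cong H (+-comm 1 k))) (slide-start a 1≤a) (ω-positive a 1≤a) k ⟩
      H (k + 1) + bit (k + 1 ≡ᵇ x)       ≡⟨ cong (λ z → H z + bit (z ≡ᵇ x)) (+-comm k 1) ⟩
      H (suc k) + bit (suc k ≡ᵇ x)       ≡⟨ sym (code-∘sₚ k) ⟩
      code ω' π' (suc k) ∎
      where open ≡-Reasoning

  tower-of-index : ∀ T → HasCode T ω π → ∀ p i → 1 ≤ p → index T p ≡ i → ω i ≡ p
  tower-of-index T hT p i 1≤p idx = trans (cong ω (trans (sym idx) (index≡π T hT p 1≤p))) (ωπ p)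

-- Induction along the word: the last letter a is an ascent of the prefix
-- (a descent would make the word non-reduced), so it is a slide step.
slideWord-code : ∀ n w → Word w → Bounded n w → inversions (evalW w) (suc n) ≡ length w →
                 HasCode (slideWord w) (evalW w) (evalInv w)
slideWord-code n w = go (reverseView w)
  where
  go : ∀ {w} → Reverse w → Word w → Bounded n w → inversions (evalW w) (suc n) ≡ length w →
       HasCode (slideWord w) (evalW w) (evalInv w)
  go [] _ _ _ k = sym (trans (sumTo-cong (suc k) (λ u u≤k → bit-≮ (≤⇒≯ (≤-pred u≤k)))) (sumTo-zeros (suc k)))
  go (u ∶ r ∶ʳ a) ww bw inv≡len k with ∷ʳ⁻ ww | ∷ʳ⁻ bw
  ... | wu , 1≤a | bu , a<n with <-cmp (evalW u a) (evalW u (suc a))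
  ... | tri≈ _ e _  = ⊥-elim (<-irrefl (evalW-injective u e) (n<1+n a))
  ... | tri> _ _ gt = ⊥-elim (m+1+n≰m (length u) (subst (_≤ length u) too-many (inversions≤length n u bu)))
    where
    too-many : inversions (evalW u) (suc n) ≡ length u + 2
    too-many = trans (inversions-sₚ-down (evalW u) (evalW-injective u) a (suc n) (s≤s a<n) gt)
      (trans (cong (_+ 1) (trans (sym (inversions-cong (suc n) (evalW-∷ʳ u a))) (trans inv≡len (trans (length-∷ʳ u a) (+-comm 1 _)))))
        (+-assoc (length u) 1 1))
  ... | tri< lt _ _ = begin
    ht (slideWord (u ∷ʳ a)) (suc k)                 ≡⟨ cong (λ T → ht T (suc k)) (foldl-∷ʳ (λ T a → slide a T) [] a u) ⟩
    ht (slide a (slideWord u)) (suc k)              ≡⟨ Slide.slide-code a 1≤a lt (slideWord u) (go r wu bu prefix) k ⟩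
    code (λ x → evalW u (sₚ a x)) (λ x → sₚ a (evalInv u x)) (suc k)
      ≡⟨ code-cong (λ x → sym (evalW-∷ʳ u a x)) (λ x → sym (evalInv-∷ʳ u a x)) (suc k) ⟩
    code (evalW (u ∷ʳ a)) (evalInv (u ∷ʳ a)) (suc k) ∎
    where
    open ≡-Reasoning
    open Code (evalW u) (evalInv u) (evalW-evalInv u) (evalInv-evalW u) (evalW-fixes-0 u wu)
    prefix : inversions (evalW u) (suc n) ≡ length u
    prefix = +-cancelʳ-≡ 1 _ _ (begin
      inversions (evalW u) (suc n) + 1            ≡⟨ sym (inversions-sₚ-up (evalW u) (evalW-injective u) a (suc n) (s≤s a<n) lt) ⟩
      inversions (λ x → evalW u (sₚ a x)) (suc n) ≡⟨ sym (inversions-cong (suc n) (evalW-∷ʳ u a)) ⟩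
      inversions (evalW (u ∷ʳ a)) (suc n)         ≡⟨ inv≡len ⟩
      length (u ∷ʳ a)                             ≡⟨ trans (length-∷ʳ u a) (+-comm 1 _) ⟩
      length u + 1 ∎)

maxLetter : List ℕ → ℕ
maxLetter = foldr _⊔_ 0

bounded : ∀ w m → maxLetter w ≤ m → Bounded (suc m) w
bounded []      m _  = []
bounded (a ∷ w) m le = s≤s (≤-trans (m≤m⊔n a _) le) ∷ bounded w m (≤-trans (m≤n⊔m a _) le)

reduced-code : ∀ {w f T} (g : ℕ → ℕ) → ReducedWordFor w f → (∀ x → g (f x) ≡ x) → slideWord w ≈T T → HasCode T f g
reduced-code {w} {f} {T} g rw@((ww , ef) , _) gf hT k = begin
  ht T (suc k)                                        ≡⟨ sym (hT (suc k)) ⟩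
  ht (slideWord w) (suc k)                            ≡⟨ slideWord-code n w ww bw (sym (reduced-length n w f rw bw)) k ⟩
  code (evalW w) (evalInv w) (suc k)                  ≡⟨ code-cong ef inverse (suc k) ⟩
  code f g (suc k) ∎
  where
  open ≡-Reasoning
  n : ℕ
  n = suc (maxLetter w)
  bw : Bounded n w
  bw = bounded w (maxLetter w) ≤-refl
  inverse : ∀ x → evalInv w x ≡ g x
  inverse x = trans (sym (gf (evalInv w x))) (cong g (trans (sym (ef (evalInv w x))) (evalW-evalInv w x)))

single-inversion-gain : ∀ (f : ℕ → ℕ) → Injective _≡_ _≡_ f → ∀ i j N → i < j → j < N →
  inversions (λ x → f (transp i j x)) N ≡ inversions f N + 1 →
  f i < f j × (∀ u → i < u → u < j → f i < f u → f u < f j → ⊥)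
single-inversion-gain f inj i j N i<j j<N gain with <-cmp (f i) (f j)
... | tri≈ _ e _  = ⊥-elim (<-irrefl (inj e) i<j)
... | tri< lt _ _ with inversions-transp-up f inj i j N i<j j<N lt
...   | B , up , no-between = lt , no-between (m+n≡0⇒m≡0 B B+B≡0)
  where
  B+B≡0 : B + B ≡ 0
  B+B≡0 = +-cancelˡ-≡ (inversions f N + 1) _ _ (trans (sym up) (trans gain (sym (+-identityʳ _))))
single-inversion-gain f inj i j N i<j j<N gain | tri> _ _ gt with inversions-transp-down f inj i j N i<j j<N gt
... | B , down = ⊥-elim (m+1+n≢m X (sym (trans down (trans (cong (λ z → z + 1 + (B + B)) gain) (regroup X B)))))
  where
  X : ℕ
  X = inversions f N
  regroup : ∀ X B → X + 1 + 1 + (B + B) ≡ X + suc (1 + (B + B))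
  regroup = solve-∀

length-additive : ∀ {w w' f} i j → ReducedWordFor w f → ReducedWordFor w' (λ x → f (transp i j x)) →
  length w' ≡ suc (length w) → i < j →
  f i < f j × (∀ u → i < u → u < j → f i < f u → f u < f j → ⊥)
length-additive {w} {w'} {f} i j rw@((_ , ef) , _) rw' len i<j = single-inversion-gain f inj i j N i<j j<N gain
  where
  m : ℕ
  m = maxLetter w ⊔ maxLetter w' ⊔ j
  N : ℕ
  N = suc (suc m)
  j<N : j < N
  j<N = s≤s (≤-trans (m≤n⊔m (maxLetter w ⊔ maxLetter w') j) (n≤1+n m))
  inj : Injective _≡_ _≡_ f
  inj {x} {y} e = evalW-injective w (trans (ef x) (trans e (sym (ef y))))
  length≡ : ∀ {v g} → ReducedWordFor v g → maxLetter v ≤ m → length v ≡ inversions g N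
  length≡ {v} rv@((_ , eg) , _) v≤m = trans (reduced-length (suc m) v _ rv (bounded v m v≤m)) (inversions-cong N eg)
  gain : inversions (λ x → f (transp i j x)) N ≡ inversions f N + 1
  gain = begin
    inversions (λ x → f (transp i j x)) N ≡⟨ sym (length≡ rw' (≤-trans (m≤n⊔m (maxLetter w) _) (m≤m⊔n _ j))) ⟩
    length w'                            ≡⟨ len ⟩
    suc (length w)                       ≡⟨ +-comm 1 _ ⟩
    length w + 1                         ≡⟨ cong (_+ 1) (length≡ rw (≤-trans (m≤m⊔n (maxLetter w) _) (m≤m⊔n _ j))) ⟩
    inversions f N + 1 ∎
    where open ≡-Reasoning

-- Comparing the codes of ω and ω ∘ t_{i,j}.

module TransposedCode (ω π : ℕ → ℕ) (ωπ : ∀ x → ω (π x) ≡ x) (πω : ∀ x → π (ω x) ≡ x) (ω0 : ω 0 ≡ 0)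
  (i d : ℕ) (1≤i : 1 ≤ i)
  (s<l : ω i < ω (suc (i + d)))
  (no-between : ∀ u → i < u → u < suc (i + d) → ω i < ω u → ω u < ω (suc (i + d)) → ⊥)
  (T T' : Tower) (codeT : HasCode T ω π)
  (codeT' : HasCode T' (λ x → ω (transp i (suc (i + d)) x)) (λ x → transp i (suc (i + d)) (π x))) where
  j : ℕ
  j = suc (i + d)
  τ : ℕ → ℕ
  τ = transp i j
  ω' : ℕ → ℕ
  ω' = λ x → ω (τ x)
  π' : ℕ → ℕ
  π' = λ x → τ (π x)
  i<j : i < j
  i<j = after i d
  s : ℕ
  s = ω i
  l : ℕ
  l = ω j
  C : ℕ → ℕ → ℕ
  C = countAbove ω
  C' : ℕ → ℕ → ℕ
  C' = countAbove ω'

  module Old = Code ω π ωπ πω ω0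
  module New = Code ω' π' (λ x → trans (cong ω (transp-involutive i j (π x))) (ωπ x))
                          (λ x → trans (cong τ (πω (τ x))) (transp-involutive i j x))
                          (trans (cong ω (transp-fix-below i j 0 1≤i i<j)) ω0)

  1≤s : 1 ≤ s
  1≤s = Old.ω-positive i 1≤i
  1≤l : 1 ≤ l
  1≤l = ≤-trans 1≤s (<⇒≤ s<l)

  -- thresholds of towers s and l: "ω u > q" is "ω u ≥ s"
  q : ℕ
  q = s ∸ 1
  ql : ℕ
  ql = l ∸ 1
  q+1≡s : suc q ≡ s
  q+1≡s = trans (+-comm 1 q) (m∸n+n≡m 1≤s)
  ql+1≡l : suc ql ≡ l
  ql+1≡l = trans (+-comm 1 ql) (m∸n+n≡m 1≤l)
  q<l : q < l
  q<l = <-trans (subst (q <_) q+1≡s (n<1+n q)) s<l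

  tower : ∀ p → 1 ≤ p → ht T p ≡ code ω π p
  tower = code-at {ω = ω} {π = π} codeT
  tower' : ∀ p → 1 ≤ p → ht T' p ≡ code ω' π' p
  tower' = code-at {ω = ω'} {π = π'} codeT'

  C'≡C-upto-i : ∀ k v → v ≤ i → C' k v ≡ C k v
  C'≡C-upto-i k v = countAbove-transp-below ω i j k v i<j

  C'≡C-strictly-between : ∀ k → sumTo (λ t → bit (k <ᵇ ω' (suc (i + t)))) d ≡ sumTo (λ t → bit (k <ᵇ ω (suc (i + t)))) d
  C'≡C-strictly-between k = sumTo-cong d (λ t t<d → cong (λ z → bit (k <ᵇ ω z)) (transp-fix-between i j _ (after i t) (within i t<d)))

  -- r = #{i < u < j ∣ ω u ≥ s}: the cells moved from tower l to tower s
  r : ℕ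
  r = sumTo (λ t → bit (q <ᵇ ω (suc (i + t)))) d

  -- by hypothesis, the same positions are those with ω u ≥ l
  r-above-l : sumTo (λ t → bit (ql <ᵇ ω (suc (i + t)))) d ≡ r
  r-above-l = sumTo-cong d (λ t t<d → cong bit (<ᵇ-cong (≤-<-trans (∸-monoˡ-≤ 1 (<⇒≤ s<l))) (at-least-l t t<d)))
    where
    at-least-l : ∀ t → t < d → q < ω (suc (i + t)) → ql < ω (suc (i + t))
    at-least-l t t<d q<ωu with l ≤? ω (suc (i + t))
    ... | yes l≤ωu = subst (_≤ ω (suc (i + t))) (sym ql+1≡l) l≤ωu
    ... | no l≰ωu  = ⊥-elim (no-between _ (after i t) (within i t<d) s<ωu (≰⇒> l≰ωu))
      where
      s<ωu : s < ω (suc (i + t))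
      s<ωu = ≤∧≢⇒< (subst (_≤ ω (suc (i + t))) q+1≡s q<ωu) (λ e → <-irrefl (Old.ω-injective e) (after i t))

  height-s : ht T s ≡ C q i
  height-s = trans (tower s 1≤s) (cong (C q) (πω i))

  height'-s : ht T' s ≡ ht T s + r + 1
  height'-s = begin
    ht T' s                  ≡⟨ tower' s 1≤s ⟩
    C' q (τ (π s))           ≡⟨ cong (λ z → C' q (τ z)) (πω i) ⟩
    C' q (τ i)               ≡⟨ cong (C' q) (transp-a i j) ⟩
    C' q j                   ≡⟨ sumTo-split (λ u → bit (q <ᵇ ω' u)) i d ⟩
    C' q i + bit (q <ᵇ ω (τ i)) + sumTo (λ t → bit (q <ᵇ ω' (suc (i + t)))) d
      ≡⟨ cong₂ (λ a b → a + bit (q <ᵇ ω b) + sumTo (λ t → bit (q <ᵇ ω' (suc (i + t)))) d) (C'≡C-upto-i q i ≤-refl) (transp-a i j) ⟩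
    C q i + bit (q <ᵇ l) + sumTo (λ t → bit (q <ᵇ ω' (suc (i + t)))) d
      ≡⟨ cong₂ (λ a b → C q i + a + b) (bit-< q<l) (C'≡C-strictly-between q) ⟩
    C q i + 1 + r            ≡⟨ +-assoc (C q i) 1 r ⟩
    C q i + (1 + r)          ≡⟨ cong (C q i +_) (+-comm 1 r) ⟩
    C q i + (r + 1)          ≡⟨ sym (+-assoc (C q i) r 1) ⟩
    C q i + r + 1            ≡⟨ cong (λ z → z + r + 1) (sym height-s) ⟩
    ht T s + r + 1 ∎
    where open ≡-Reasoning

  height-l : ht T l ≡ C ql i + r
  height-l = begin
    ht T l                   ≡⟨ tower l 1≤l ⟩
    C ql (π l)               ≡⟨ cong (C ql) (πω j) ⟩
    C ql j                   ≡⟨ sumTo-split (λ u → bit (ql <ᵇ ω u)) i d ⟩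
    C ql i + bit (ql <ᵇ s) + sumTo (λ t → bit (ql <ᵇ ω (suc (i + t)))) d
      ≡⟨ cong₂ (λ a b → C ql i + a + b) (bit-≮ (≤⇒≯ (≤-pred (subst (s <_) (sym ql+1≡l) s<l)))) r-above-l ⟩
    C ql i + 0 + r           ≡⟨ cong (_+ r) (+-identityʳ _) ⟩
    C ql i + r ∎
    where open ≡-Reasoning

  height'-l : ht T' l ≡ C ql i
  height'-l = begin
    ht T' l                  ≡⟨ tower' l 1≤l ⟩
    C' ql (τ (π l))          ≡⟨ cong (λ z → C' ql (τ z)) (πω j) ⟩
    C' ql (τ j)              ≡⟨ cong (C' ql) (transp-b i j) ⟩
    C' ql i                  ≡⟨ C'≡C-upto-i ql i ≤-refl ⟩
    C ql i ∎
    where open ≡-Reasoning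

  -- a value p ∉ {s, l} at a position v strictly between i and j is not
  -- between s and l, so the threshold p-1 treats s and l alike
  unchanged-between : ∀ p → p ≢ l → ∀ t → suc (i + t) < j → ω (suc (i + t)) ≡ p →
    C' (p ∸ 1) (suc (i + t)) ≡ C (p ∸ 1) (suc (i + t))
  unchanged-between p p≢l t v<j ωv≡p = begin
    C' k (suc (i + t))    ≡⟨ sumTo-split (λ u → bit (k <ᵇ ω' u)) i t ⟩
    C' k i + bit (k <ᵇ ω (τ i)) + sumTo (λ t' → bit (k <ᵇ ω' (suc (i + t')))) t
      ≡⟨ cong₂ (λ a b → a + bit (k <ᵇ ω b) + sumTo (λ t' → bit (k <ᵇ ω' (suc (i + t')))) t) (C'≡C-upto-i k i ≤-refl) (transp-a i j) ⟩
    C k i + bit (k <ᵇ l) + sumTo (λ t' → bit (k <ᵇ ω' (suc (i + t')))) t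
      ≡⟨ cong₂ (λ a b → C k i + a + b) (cong bit (<ᵇ-cong l→s (λ k<s → <-trans k<s s<l))) inside ⟩
    C k i + bit (k <ᵇ s) + sumTo (λ t' → bit (k <ᵇ ω (suc (i + t')))) t
      ≡⟨ sym (sumTo-split (λ u → bit (k <ᵇ ω u)) i t) ⟩
    C k (suc (i + t)) ∎
    where
    open ≡-Reasoning
    k : ℕ
    k = p ∸ 1
    1≤p : 1 ≤ p
    1≤p = subst (1 ≤_) ωv≡p (Old.ω-positive _ (s≤s z≤n))
    k+1≡p : suc k ≡ p
    k+1≡p = trans (+-comm 1 k) (m∸n+n≡m 1≤p)
    inside : sumTo (λ t' → bit (k <ᵇ ω' (suc (i + t')))) t ≡ sumTo (λ t' → bit (k <ᵇ ω (suc (i + t')))) t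
    inside = sumTo-cong t (λ t' t'<t → cong (λ z → bit (k <ᵇ ω z))
               (transp-fix-between i j _ (after i t') (<-trans (within i t'<t) v<j)))
    l→s : k < l → k < s
    l→s k<l with k <? s
    ... | yes k<s = k<s
    ... | no k≮s  = ⊥-elim (no-between _ (after i t) v<j
                      (subst (s <_) (trans k+1≡p (sym ωv≡p)) (s≤s (≮⇒≥ k≮s)))
                      (subst (_< l) (sym ωv≡p) (≤∧≢⇒< (subst (_≤ l) k+1≡p k<l) p≢l)))

  height'-other : ∀ p → 1 ≤ p → p ≢ s → p ≢ l → ht T' p ≡ ht T p
  height'-other p 1≤p p≢s p≢l =
    trans (tower' p 1≤p) (trans (cong (C' (p ∸ 1)) τv≡v) (trans (same-count (<-cmp v i)) (sym (tower p 1≤p))))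
    where
    v : ℕ
    v = π p
    v≢i : v ≢ i
    v≢i e = p≢s (trans (sym (ωπ p)) (cong ω e))
    v≢j : v ≢ j
    v≢j e = p≢l (trans (sym (ωπ p)) (cong ω e))
    τv≡v : τ v ≡ v
    τv≡v = transp-other i j v v≢i v≢j
    Same : ℕ → Set
    Same u = C' (p ∸ 1) u ≡ C (p ∸ 1) u
    same-count : Tri (v < i) (v ≡ i) (i < v) → C' (p ∸ 1) v ≡ C (p ∸ 1) v
    same-count (tri< v<i _ _) = C'≡C-upto-i (p ∸ 1) v (<⇒≤ v<i)
    same-count (tri≈ _ v≡i _) = ⊥-elim (v≢i v≡i)
    same-count (tri> _ _ i<v) with <-cmp v j
    ... | tri≈ _ v≡j _ = ⊥-elim (v≢j v≡j)
    ... | tri< v<j _ _ with m≤n⇒∃[o]m+o≡n i<v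
    ...   | t , eq = subst Same eq (unchanged-between p p≢l t (subst (_< j) (sym eq) v<j) (trans (cong ω eq) (ωπ p)))
    same-count (tri> _ _ i<v) | tri> _ _ j<v with m≤n⇒∃[o]m+o≡n j<v
    ...   | e , eq = subst Same eq (count-transp (λ u → (p ∸ 1) <ᵇ ω u) i d e)

  index'-s : index T' s ≡ j
  index'-s = trans (New.index≡π T' codeT' s 1≤s) (trans (cong τ (πω i)) (transp-a i j))

  index'-l : index T' l ≡ i
  index'-l = trans (New.index≡π T' codeT' l 1≤l) (trans (cong τ (πω j)) (transp-b i j))

  -- the new cell (s, T_s) flies to position i: both are positions of value
  -- ≥ s in ω' with C q i earlier such positions
  flight-new-cell : fn T' s (ht T s) ≡ i
  flight-new-cell rewrite height-s with New.flight T' codeT' q (C q i)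
  ... | q<ω'v , count≡ = New.countAbove-injective q q<ω'v (subst (q <_) (sym (cong ω (transp-a i j))) q<l)
                           (trans count≡ (sym (C'≡C-upto-i q i ≤-refl)))

  result : (Σ ℕ λ r → r ≤ ht T l × ht T' s ≡ ht T s + r + 1 × ht T' l ≡ ht T l ∸ r
             × ((p : ℕ) → 1 ≤ p → p ≢ s → p ≢ l → ht T' p ≡ ht T p))
           × index T' s ≡ j × index T' l ≡ i × fn T' s (ht T s) ≡ i
  result = (r , subst (r ≤_) (sym height-l) (m≤n+m r _) , height'-s ,
            trans height'-l (sym (trans (cong (_∸ r) height-l) (m+n∸n≡m _ r))) , height'-other) ,
           index'-s , index'-l , flight-new-cell

transposition-towers : ∀ (ω π : ℕ → ℕ) → (∀ x → ω (π x) ≡ x) → (∀ x → π (ω x) ≡ x) → ω 0 ≡ 0 →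
  ∀ i j → 1 ≤ i → i < j → ω i < ω j → (∀ u → i < u → u < j → ω i < ω u → ω u < ω j → ⊥) →
  ∀ T T' → HasCode T ω π → HasCode T' (λ x → ω (transp i j x)) (λ x → transp i j (π x)) →
  ∀ s l → ω i ≡ s → ω j ≡ l →
  (Σ ℕ λ r → r ≤ ht T l × ht T' s ≡ ht T s + r + 1 × ht T' l ≡ ht T l ∸ r
     × ((p : ℕ) → 1 ≤ p → p ≢ s → p ≢ l → ht T' p ≡ ht T p))
  × index T' s ≡ j × index T' l ≡ i × fn T' s (ht T s) ≡ i
transposition-towers ω π ωπ πω ω0 i j 1≤i i<j s<l no-between T T' codeT codeT' .(ω i) .(ω j) refl refl
  with m≤n⇒∃[o]m+o≡n i<j
... | d , refl = TransposedCode.result ω π ωπ πω ω0 i d 1≤i s<l no-between T T' codeT codeT'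

corollary4p5 :
    (T : Tower) (w : List ℕ) → ReducedWordFor w (evalW w) → slideWord w ≈T T →
    (i j : ℕ) → 1 ≤ i → i < j →
    (s l : ℕ) → 1 ≤ s → 1 ≤ l → index T s ≡ i → index T l ≡ j →
    (HasLength (λ x → evalW w (transp i j x)) (suc (length w)) → s < l)
    × ((w' : List ℕ) → ReducedWordFor w' (λ x → evalW w (transp i j x)) →
       length w' ≡ suc (length w) →
       (T' : Tower) → slideWord w' ≈T T' →
       (Σ ℕ λ r → r ≤ ht T l × ht T' s ≡ ht T s + r + 1 × ht T' l ≡ ht T l ∸ r
          × ((p : ℕ) → 1 ≤ p → p ≢ s → p ≢ l → ht T' p ≡ ht T p))
       × index T' s ≡ j × index T' l ≡ i × fn T' s (ht T s) ≡ i)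
corollary4p5 T w rw slid i j 1≤i i<j s l 1≤s 1≤l index-s index-l =
  (λ (w'' , rw'' , len) → subst₂ _<_ ωi≡s ωj≡l (proj₁ (length-additive i j rw rw'' len i<j))) ,
  λ w' rw' len T' slid' → let (s<l , no-between) = length-additive i j rw rw' len i<j in
    transposition-towers ω π ωπ πω ω0 i j 1≤i i<j s<l no-between T T' codeT (codeT' rw' slid') s l ωi≡s ωj≡l
  where
  ω : ℕ → ℕ
  ω = evalW w
  π : ℕ → ℕ
  π = evalInv w
  ωπ : ∀ x → ω (π x) ≡ x
  ωπ = evalW-evalInv w
  πω : ∀ x → π (ω x) ≡ x
  πω = evalInv-evalW w
  ω0 : ω 0 ≡ 0
  ω0 = evalW-fixes-0 w (proj₁ (proj₁ rw))
  codeT : HasCode T ω π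
  codeT = reduced-code π rw πω slid
  ωi≡s : ω i ≡ s
  ωi≡s = Code.tower-of-index ω π ωπ πω ω0 T codeT s i 1≤s index-s
  ωj≡l : ω j ≡ l
  ωj≡l = Code.tower-of-index ω π ωπ πω ω0 T codeT l j 1≤l index-l
  codeT' : ∀ {w' T'} → ReducedWordFor w' (λ x → ω (transp i j x)) → slideWord w' ≈T T' →
           HasCode T' (λ x → ω (transp i j x)) (λ x → transp i j (π x))
  codeT' rw' slid' = reduced-code (λ x → transp i j (π x)) rw' inverse slid'
    where
    inverse : ∀ x → transp i j (π (ω (transp i j x))) ≡ x
    inverse x = trans (cong (transp i j) (πω (transp i j x))) (transp-involutive i j x)
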